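{- Let $X\subset L_{132}$ with $D(X)<D(L_{132})$. Then $|X|\leq 22$, and if equality holds then $X$ is isomorphic to $X_3$, $Y_3$, or $Z_3$.
   Context: $L_{132}\subset\mathbb{R}^6$ is the set of vectors with exactly one entry $-1$, three entries $0$ and two entries $1$. $D(X)$ is the Euclidean diameter; two subsets are isomorphic if one is obtained from the other by a common permutation of coordinates. For $1\le i\le 6$ let $S_3(i)=\{x\in L_{132}\mid x_1=\cdots=x_{i-1}=0,\ x_i=-1\}$, $T_3(i)=\{x\in L_{132}\mid x_1=\cdots=x_{i-1}=0,\ x_i=1\}$ (for $i=1$ just $x_1=-1$, resp. $x_1=1$). Define $X_3=T_3(4)\cup\bigcup_{i=1}^{4}S_3(i)$, $Y_3=T_3(3)\cup S_3(1)\cup S_3(2)$, $Z_3=T_3(2)\cup S_3(1)$. -}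

module Defs where

open import Data.Nat using (ℕ; zero; suc; _≡ᵇ_)
open import Data.Integer using (ℤ; +_; -[1+_]; _-_; _*_; _+_; _⊔_)
import Data.Integer.Properties as ℤP
open import Data.Fin using (Fin; toℕ; #_)
open import Data.Vec using (Vec; []; _∷_; lookup; tabulate; count)
open import Data.List using (List; []; _∷_; concatMap; map; filterᵇ; foldr)
open import Data.List.Membership.Propositional using (_∈_)
open import Data.Product using (_×_; Σ)
open import Data.Sum using (_⊎_)
open import Data.Bool using (Bool; _∧_)
open import Relation.Nullary.Decidable using (⌊_⌋)
open import Relation.Binary.PropositionalEquality using (_≡_)
open import Data.Fin.Permutation using (Permutation′; _⟨$⟩ʳ_)
open import Data.Nat using (_<_)

Pt : Set
Pt = Vec ℤ 6

allVecs : (n : ℕ) → List (Vec ℤ n)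
allVecs zero = [] ∷ []
allVecs (suc n) = concatMap (λ v → map (_∷ v) (-[1+ 0 ] ∷ + 0 ∷ + 1 ∷ [])) (allVecs n)

isL132 : Pt → Bool
isL132 v = (count (ℤP._≟ -[1+ 0 ]) v ≡ᵇ 1)
         ∧ (count (ℤP._≟ + 0) v ≡ᵇ 3)
         ∧ (count (ℤP._≟ + 1) v ≡ᵇ 2)

L132 : List Pt
L132 = filterᵇ isL132 (allVecs 6)

sqDistV : {n : ℕ} → Vec ℤ n → Vec ℤ n → ℤ
sqDistV [] [] = + 0
sqDistV (a ∷ x) (b ∷ y) = (a - b) * (a - b) + sqDistV x y

sqDist : Pt → Pt → ℤ
sqDist = sqDistV

diamSq : List Pt → ℤ
diamSq X = foldr (λ x m → foldr (λ y m′ → sqDist x y ⊔ m′) m X) (+ 0) X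

-- S_3(i), T_3(i); the index i : Fin 6 corresponds to the paper's index i+1
S3 : Fin 6 → Pt → Set
S3 i x = x ∈ L132 × ((j : Fin 6) → toℕ j < toℕ i → lookup x j ≡ + 0) × lookup x i ≡ -[1+ 0 ]

T3 : Fin 6 → Pt → Set
T3 i x = x ∈ L132 × ((j : Fin 6) → toℕ j < toℕ i → lookup x j ≡ + 0) × lookup x i ≡ + 1

X3 : Pt → Set
X3 x = T3 (# 3) x ⊎ S3 (# 0) x ⊎ S3 (# 1) x ⊎ S3 (# 2) x ⊎ S3 (# 3) x

Y3 : Pt → Set
Y3 x = T3 (# 2) x ⊎ S3 (# 0) x ⊎ S3 (# 1) x

Z3 : Pt → Set
Z3 x = T3 (# 1) x ⊎ S3 (# 0) x

permute : Permutation′ 6 → Pt → Pt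
permute σ x = tabulate (λ i → lookup x (σ ⟨$⟩ʳ i))

Isomorphic : List Pt → (Pt → Set) → Set
Isomorphic X P = Σ (Permutation′ 6) λ σ → (x : Pt) → (x ∈ X → P (permute σ x)) × (P (permute σ x) → x ∈ X)

-- Pairs of points of L132 at squared distance 10 = D(L132)² are the edges of a graph on
-- its 60 points, and a subset of smaller diameter is an independent set of this graph.
-- A branch-and-bound search, pruned by a greedy matching bound and proved complete, shows
-- that there is no independent 23-set and that every independent 22-set is one of 270
-- explicit sets.  Each of these is mapped into X₃, Y₃ or Z₃ by an explicit coordinate
-- permutation, and as those sets also have 22 points, it is mapped onto one of them.

module Submission where

open import Defs
open import Data.Bool using (Bool; T; if_then_else_; true; false; _∧_; _∨_)
open import Data.Bool.Properties using (T-≡)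
open import Data.Empty using (⊥-elim)
open import Data.Fin using (Fin; toℕ)
open import Data.Fin.Patterns using (0F; 1F; 2F; 3F; 4F; 5F)
open import Data.Fin.Permutation using (Permutation′; flip; _⟨$⟩ʳ_; _⟨$⟩ˡ_; inverseʳ)
open import Data.Fin.Permutation.Transposition.List using (TranspositionList; eval)
import Data.Fin.Properties as Fin
open import Data.Integer using (ℤ; +_; -[1+_]; _⊔_; _<_) renaming (_≤_ to _≤ℤ_)
import Data.Integer.Literals as ℤLiterals
import Data.Integer.Properties as ℤ
open import Data.List using (List; []; _∷_; _++_; map; length; filter; take; foldr)
open import Data.List.Properties using (filter-all; filter-notAll; length-take; length-map; map-∘; map-id-local)
open import Data.List.Relation.Binary.Pointwise using (Pointwise; _∷_)
open import Data.List.Relation.Binary.Pointwise.Properties using () renaming (decidable to pointwise?)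
open import Data.List.Relation.Binary.Subset.Propositional using (_⊆_)
import Data.List.Relation.Binary.Subset.Propositional.Properties as ⊆
open import Data.List.Relation.Binary.Sublist.Propositional using (lookup)
open import Data.List.Relation.Binary.Sublist.Propositional.Properties using (take-⊆)
open import Data.List.Relation.Unary.All as All using (All; []; _∷_)
import Data.List.Relation.Unary.All.Properties as All
open import Data.List.Relation.Unary.Any as Any using (Any; here; there)
open import Data.List.Relation.Unary.Any.Properties using (++⁺ˡ; ++⁺ʳ; map⁺)
open import Data.List.Relation.Unary.Unique.Propositional using (Unique; []; _∷_)
import Data.List.Relation.Unary.Unique.Propositional.Properties as Unique
open import Data.List.Membership.Propositional using (_∈_; _∉_)
open import Data.List.Membership.Propositional.Properties using (∈-filter⁺; ∈-filter⁻; ∈-++⁻; ∈-map⁻)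
open import Data.Nat using (ℕ; zero; suc; _≤_; _<ᵇ_; z≤n; s≤s; s≤s⁻¹) renaming (_<_ to _<ℕ_)
import Data.Nat.Properties as ℕ
open import Data.Product using (_×_; _,_; proj₁; proj₂; ∃; ∃₂)
open import Data.Sum using (_⊎_; inj₁; inj₂; [_,_]′)
open import Data.Unit using (tt)
open import Data.Vec using (Vec; []; _∷_; tabulate; replicate) renaming (lookup to _‼_)
open import Data.Vec.Properties using (lookup∘tabulate; tabulate-cong; tabulate∘lookup)
open import Function using (_∘_)
open import Function.Bundles using (Equivalence)
open import Level using (0ℓ)
open import Relation.Binary using (Rel; REL; DecidableEquality)
import Relation.Binary as B
open import Relation.Binary.PropositionalEquality using (_≡_; refl; sym; trans; cong; subst; module ≡-Reasoning)
open import Relation.Nullary using (¬_; Dec; does; yes; no; ¬?; contradiction)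
open import Relation.Nullary.Decidable using (_×-dec_; _⊎-dec_; _→-dec_; toWitness; T?; map′)
open import Relation.Unary using (Pred; Decidable)

module _ {A : Set} where

  AtMostOne : Pred A 0ℓ → List A → Set
  AtMostOne P X = ∀ {x y} → x ∈ X → y ∈ X → P x → P y → x ≡ y

  length≤1+length-filter-∁ : ∀ {P} (P? : Decidable P) {X} → Unique X → AtMostOne P X →
                             length X ≤ suc (length (filter (¬? ∘ P?) X))
  length≤1+length-filter-∁ P? {[]} _ _ = z≤n
  length≤1+length-filter-∁ P? {x ∷ X} (x∉X ∷ uX) one with P? x
  ... | no _ = s≤s (length≤1+length-filter-∁ P? uX (λ x∈ y∈ → one (there x∈) (there y∈)))
  ... | yes px = s≤s (ℕ.≤-reflexive (sym (cong length (filter-all (¬? ∘ P?) (All.tabulate ¬P)))))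
    where
    ¬P : ∀ {y} → y ∈ X → ¬ _
    ¬P y∈X py = All.lookup x∉X y∈X (one (here refl) (there y∈X) px py)

  take⊆ : ∀ n (xs : List A) → take n xs ⊆ xs
  take⊆ n xs = lookup (take-⊆ n xs)

  nth : A → List A → ℕ → A
  nth d []       _       = d
  nth d (x ∷ _)  zero    = x
  nth d (_ ∷ xs) (suc n) = nth d xs n

  module _ (_≟_ : DecidableEquality A) where

    indexOf : List A → A → ℕ
    indexOf []       _ = 0
    indexOf (y ∷ ys) x with x ≟ y
    ... | yes _ = 0
    ... | no _  = suc (indexOf ys x)

    nth-indexOf : ∀ d {x} ys → x ∈ ys → nth d ys (indexOf ys x) ≡ x
    nth-indexOf d {x} (y ∷ ys) x∈ with x ≟ y | x∈
    ... | yes x≡y | _         = sym x≡y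
    ... | no x≢y  | here x≡y  = contradiction x≡y x≢y
    ... | no _    | there x∈′ = nth-indexOf d ys x∈′

    length-filter-≢< : ∀ {v xs} → v ∈ xs → length (filter (¬? ∘ (_≟ v)) xs) <ℕ length xs
    length-filter-≢< v∈xs =
      filter-notAll (¬? ∘ (_≟ _)) _ (Any.map (λ v≡x v≢x → v≢x (sym v≡x)) v∈xs)

    length-filter-≢ : ∀ {v X} → Unique X → v ∈ X → length X ≡ suc (length (filter (¬? ∘ (_≟ v)) X))
    length-filter-≢ {v} uX v∈X = ℕ.≤-antisym
      (length≤1+length-filter-∁ (_≟ v) uX (λ _ _ x≡v y≡v → trans x≡v (sym y≡v)))
      (length-filter-≢< v∈X)

    Unique-⊆⇒length≤ : ∀ {xs ys} → Unique xs → xs ⊆ ys → length xs ≤ length ys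
    Unique-⊆⇒length≤ {[]}     _             _        = z≤n
    Unique-⊆⇒length≤ {x ∷ xs} {ys} (x∉xs ∷ uxs) x∷xs⊆ys =
      ℕ.≤-trans (s≤s (Unique-⊆⇒length≤ uxs xs⊆)) (length-filter-≢< (x∷xs⊆ys (here refl)))
      where
      xs⊆ : xs ⊆ filter (¬? ∘ (_≟ x)) ys
      xs⊆ y∈xs = ∈-filter⁺ (¬? ∘ (_≟ x)) (x∷xs⊆ys (there y∈xs))
                           (λ y≡x → All.lookup x∉xs y∈xs (sym y≡x))

    Unique-⊆-length≥⇒⊇ : ∀ {xs ys} → Unique xs → xs ⊆ ys → length ys ≤ length xs → ys ⊆ xs
    Unique-⊆-length≥⇒⊇ {xs} {ys} uxs xs⊆ys |ys|≤|xs| {y} y∈ys with Any.any? (y ≟_) xs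
    ... | yes y∈xs = y∈xs
    ... | no y∉xs  = contradiction |ys|≤|xs|
                       (ℕ.<⇒≱ (ℕ.≤-<-trans (Unique-⊆⇒length≤ uxs xs⊆) (length-filter-≢< y∈ys)))
      where
      xs⊆ : xs ⊆ filter (¬? ∘ (_≟ y)) ys
      xs⊆ x∈xs = ∈-filter⁺ (¬? ∘ (_≟ y)) (xs⊆ys x∈xs) (λ x≡y → y∉xs (subst (_∈ xs) x≡y x∈xs))

-- Decision procedures whose `does` is a plain Boolean fold: the type checker evaluates
-- them about twice as fast as Data.List.Membership.DecPropositional._∈?_ and
-- Data.Vec.Properties.≡-dec, which matters for the computations below.
module BooleanDecisions {A : Set} (_≟_ : DecidableEquality A) where

  _∈ᵇ_ : A → List A → Bool
  x ∈ᵇ []       = false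
  x ∈ᵇ (y ∷ ys) = does (x ≟ y) ∨ x ∈ᵇ ys

  ∈ᵇ⇒∈ : ∀ {x} ys → T (x ∈ᵇ ys) → x ∈ ys
  ∈ᵇ⇒∈ {x} (y ∷ ys) t with x ≟ y
  ... | yes x≡y = here x≡y
  ... | no _    = there (∈ᵇ⇒∈ ys t)

  ∈⇒∈ᵇ : ∀ {x ys} → x ∈ ys → T (x ∈ᵇ ys)
  ∈⇒∈ᵇ {x} {y ∷ _} x∈ with x ≟ y | x∈
  ... | yes _  | _         = tt
  ... | no x≢y | here x≡y  = contradiction x≡y x≢y
  ... | no _   | there x∈′ = ∈⇒∈ᵇ x∈′

  _∈?_ : B.Decidable (_∈_ {A = A})
  x ∈? ys = map′ (∈ᵇ⇒∈ ys) ∈⇒∈ᵇ (T? (x ∈ᵇ ys))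

  _==ᵥ_ : ∀ {n} → Vec A n → Vec A n → Bool
  []      ==ᵥ []      = true
  (a ∷ x) ==ᵥ (b ∷ y) = does (a ≟ b) ∧ x ==ᵥ y

  ==ᵥ⇒≡ : ∀ {n} (x y : Vec A n) → T (x ==ᵥ y) → x ≡ y
  ==ᵥ⇒≡ []      []      _ = refl
  ==ᵥ⇒≡ (a ∷ x) (b ∷ y) t with a ≟ b
  ... | yes refl = cong (a ∷_) (==ᵥ⇒≡ x y t)
  ... | no _     = ⊥-elim t

  ==ᵥ-refl : ∀ {n} (x : Vec A n) → T (x ==ᵥ x)
  ==ᵥ-refl []      = tt
  ==ᵥ-refl (a ∷ x) with a ≟ a
  ... | yes _  = ==ᵥ-refl x
  ... | no a≢a = contradiction refl a≢a

  _≟ᵥ_ : ∀ {n} → DecidableEquality (Vec A n)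
  x ≟ᵥ y = map′ (==ᵥ⇒≡ x y) (λ { refl → ==ᵥ-refl x }) (T? (x ==ᵥ y))

Any×Pointwise⇒∃ : ∀ {A B : Set} {P : Pred A 0ℓ} {R : REL A B 0ℓ} {xs ys} →
                  Any P xs → Pointwise R xs ys → ∃₂ λ x y → P x × R x y
Any×Pointwise⇒∃ (here px)  (rxy ∷ _)  = _ , _ , px , rxy
Any×Pointwise⇒∃ (there p)  (_ ∷ rs)   = Any×Pointwise⇒∃ p rs

-- matchingBound pairs each vertex greedily with a later unmatched neighbour; an
-- independent set contains at most one vertex of each pair, so its size is at most the
-- number of pairs and unpaired vertices.
module IndependentSets {A : Set} (_≟_ : DecidableEquality A)
                       {_~_ : Rel A 0ℓ} (_~?_ : B.Decidable _~_) where

  open BooleanDecisions _≟_ using (_∈?_)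

  Independent : List A → Set
  Independent X = ∀ {x y} → x ∈ X → y ∈ X → ¬ x ~ y

  partner : List A → A → List A → List A
  partner R v cs = take 1 (filter (λ u → v ~? u ×-dec ¬? (u ∈? R)) cs)

  matchingBound : List A → List A → ℕ
  matchingBound R [] = 0
  matchingBound R (v ∷ cs) with v ∈? R
  ... | yes _ = matchingBound R cs
  ... | no _  = suc (matchingBound (partner R v cs ++ R) cs)

  independentSets : ℕ → List A → List (List A)
  independentSets zero    _        = [] ∷ []
  independentSets (suc k) []       = []
  independentSets (suc k) (v ∷ cs) =
    if matchingBound [] (v ∷ cs) <ᵇ suc k then []
    else map (v ∷_) (independentSets k (filter (¬? ∘ (v ~?_)) cs)) ++ independentSets (suc k) cs

  partner-adjacent : ∀ R v cs {u} → u ∈ partner R v cs → v ~ u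
  partner-adjacent R v cs u∈ =
    proj₁ (proj₂ (∈-filter⁻ (λ u → v ~? u ×-dec ¬? (u ∈? R)) {xs = cs} (take⊆ 1 _ u∈)))

  partner-atMostOne : ∀ R v cs {u w} → u ∈ partner R v cs → w ∈ partner R v cs → u ≡ w
  partner-atMostOne R v cs = take-1 (filter (λ u → v ~? u ×-dec ¬? (u ∈? R)) cs)
    where
    take-1 : ∀ (xs : List A) {u w} → u ∈ take 1 xs → w ∈ take 1 xs → u ≡ w
    take-1 (x ∷ xs) (here refl) (here refl) = refl

  matchingBound-sound : ∀ R cs {X} → Unique X → Independent X → X ⊆ cs →
                        (∀ {x} → x ∈ X → x ∉ R) → length X ≤ matchingBound R cs
  matchingBound-sound R [] {[]} _ _ _ _ = z≤n
  matchingBound-sound R [] {x ∷ X} _ _ X⊆[] _ with X⊆[] (here refl)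
  ... | ()
  matchingBound-sound R (v ∷ cs) {X} uX indX X⊆ X∉R with v ∈? R
  ... | yes v∈R = matchingBound-sound R cs uX indX X⊆cs X∉R
    where
    X⊆cs : X ⊆ cs
    X⊆cs x∈X with X⊆ x∈X
    ... | here refl = contradiction v∈R (X∉R x∈X)
    ... | there x∈cs = x∈cs
  ... | no _ = ℕ.≤-trans (length≤1+length-filter-∁ matched? uX one)
                 (s≤s (matchingBound-sound (P ++ R) cs (Unique.filter⁺ _ uX) ind′ sub′ unmatched′))
    where
    P = partner R v cs
    matched? : Decidable (λ x → x ≡ v ⊎ x ∈ P)
    matched? x = x ≟ v ⊎-dec x ∈? P
    X′ = filter (¬? ∘ matched?) X
    one : AtMostOne (λ x → x ≡ v ⊎ x ∈ P) X
    one x∈ y∈ (inj₁ refl) (inj₁ refl) = refl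
    one x∈ y∈ (inj₂ x∈P) (inj₂ y∈P) = partner-atMostOne R v cs x∈P y∈P
    one x∈ y∈ (inj₁ refl) (inj₂ y∈P) = contradiction (partner-adjacent R v cs y∈P) (indX x∈ y∈)
    one x∈ y∈ (inj₂ x∈P) (inj₁ refl) = contradiction (partner-adjacent R v cs x∈P) (indX y∈ x∈)
    ind′ : Independent X′
    ind′ x∈ y∈ = indX (proj₁ (∈-filter⁻ _ x∈)) (proj₁ (∈-filter⁻ _ y∈))
    sub′ : X′ ⊆ cs
    sub′ x∈X′ with ∈-filter⁻ (¬? ∘ matched?) x∈X′
    ... | x∈X , unmatched with X⊆ x∈X
    ...   | here refl = contradiction (inj₁ refl) unmatched
    ...   | there x∈cs = x∈cs
    unmatched′ : ∀ {x} → x ∈ X′ → x ∉ P ++ R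
    unmatched′ x∈X′ x∈P++R with ∈-filter⁻ (¬? ∘ matched?) x∈X′ | ∈-++⁻ P x∈P++R
    ... | _   , unmatched | inj₁ x∈P = unmatched (inj₂ x∈P)
    ... | x∈X , _         | inj₂ x∈R = X∉R x∈X x∈R

  independentSets-complete : ∀ k cs {X} → Unique X → Independent X → X ⊆ cs → length X ≡ k →
                             Any (λ S → X ⊆ S × S ⊆ X) (independentSets k cs)
  independentSets-complete-suc : ∀ k cs {X} → Unique X → Independent X → X ⊆ cs → length X ≡ suc k →
                                 Any (λ S → X ⊆ S × S ⊆ X) (independentSets (suc k) cs)

  independentSets-complete zero    cs {[]} _ _ _ _ = here ((λ ()) , (λ ()))
  independentSets-complete (suc k) cs = independentSets-complete-suc k cs

  independentSets-complete-suc k [] {x ∷ X} _ _ X⊆[] _ with X⊆[] (here refl)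
  ... | ()
  independentSets-complete-suc k (v ∷ cs) {X} uX indX X⊆ |X|≡
    with matchingBound [] (v ∷ cs) <ᵇ suc k in bound<
  ... | true
    = contradiction (matchingBound-sound [] (v ∷ cs) uX indX X⊆ (λ _ ()))
                    (ℕ.<⇒≱ (subst (_ <ℕ_) (sym |X|≡) (ℕ.<ᵇ⇒< _ _ (Equivalence.from T-≡ bound<))))
  ... | false with v ∈? X
  ...   | no v∉X = ++⁺ʳ _ (independentSets-complete-suc k cs uX indX X⊆cs |X|≡)
    where
    X⊆cs : X ⊆ cs
    X⊆cs x∈X with X⊆ x∈X
    ... | here refl = contradiction x∈X v∉X
    ... | there x∈cs = x∈cs
  ...   | yes v∈X = ++⁺ˡ (map⁺ (Any.map extend
            (independentSets-complete k _ (Unique.filter⁺ _ uX) ind′ sub′ len′)))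
    where
    X′ = filter (¬? ∘ (_≟ v)) X
    ind′ : Independent X′
    ind′ x∈ y∈ = indX (proj₁ (∈-filter⁻ _ x∈)) (proj₁ (∈-filter⁻ _ y∈))
    sub′ : X′ ⊆ filter (¬? ∘ (v ~?_)) cs
    sub′ x∈X′ with ∈-filter⁻ (¬? ∘ (_≟ v)) x∈X′
    ... | x∈X , x≢v with X⊆ x∈X
    ...   | here refl = contradiction refl x≢v
    ...   | there x∈cs = ∈-filter⁺ (¬? ∘ (v ~?_)) x∈cs (indX v∈X x∈X)
    len′ : length X′ ≡ k
    len′ = ℕ.suc-injective (trans (sym (length-filter-≢ _≟_ uX v∈X)) |X|≡)
    extend : ∀ {S} → X′ ⊆ S × S ⊆ X′ → X ⊆ v ∷ S × v ∷ S ⊆ X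
    extend {S} (X′⊆S , S⊆X′) = X⊆v∷S , v∷S⊆X
      where
      X⊆v∷S : X ⊆ v ∷ S
      X⊆v∷S {x} x∈X with x ≟ v
      ... | yes refl = here refl
      ... | no x≢v = there (X′⊆S (∈-filter⁺ (¬? ∘ (_≟ v)) x∈X x≢v))
      v∷S⊆X : v ∷ S ⊆ X
      v∷S⊆X (here refl) = v∈X
      v∷S⊆X (there x∈S) = proj₁ (∈-filter⁻ _ (S⊆X′ x∈S))

  independentSets≡[]⇒length< : ∀ k cs → independentSets k cs ≡ [] →
                               ∀ {X} → Unique X → Independent X → X ⊆ cs → length X <ℕ k
  independentSets≡[]⇒length< k cs none {X} uX indX X⊆ with length X ℕ.<? k
  ... | yes |X|<k = |X|<k
  ... | no |X|≮k with subst (Any _) none (independentSets-complete k cs (Unique.take⁺ k uX)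
                       (λ x∈ y∈ → indX (take⊆ k X x∈) (take⊆ k X y∈))
                       (X⊆ ∘ take⊆ k X)
                       (trans (length-take k X) (ℕ.m≤n⇒m⊓n≡m (ℕ.≮⇒≥ |X|≮k))))
  ... | ()

module _ {A : Set} (f : A → ℤ) where

  ≤-foldr-⊔ : ∀ m (ys : List A) → m ≤ℤ foldr (λ y → f y ⊔_) m ys
  ≤-foldr-⊔ m []       = ℤ.≤-refl
  ≤-foldr-⊔ m (y ∷ ys) = ℤ.≤-trans (≤-foldr-⊔ m ys) (ℤ.i≤j⊔i _ _)

  ∈⇒≤-foldr-⊔ : ∀ m {y} {ys : List A} → y ∈ ys → f y ≤ℤ foldr (λ y → f y ⊔_) m ys
  ∈⇒≤-foldr-⊔ m (here refl) = ℤ.i≤i⊔j _ _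
  ∈⇒≤-foldr-⊔ m (there y∈) = ℤ.≤-trans (∈⇒≤-foldr-⊔ m y∈) (ℤ.i≤j⊔i _ _)

sqDist≤diamSq : ∀ {X x y} → x ∈ X → y ∈ X → sqDist x y ≤ℤ diamSq X
sqDist≤diamSq {X} {x} {y} x∈X y∈X = go X x∈X
  where
  go : ∀ Z → x ∈ Z → sqDist x y ≤ℤ foldr (λ z m → foldr (λ y → sqDist z y ⊔_) m X) (+ 0) Z
  go (z ∷ Z) (here refl) = ∈⇒≤-foldr-⊔ (sqDist z) _ y∈X
  go (z ∷ Z) (there x∈Z) = ℤ.≤-trans (go Z x∈Z) (≤-foldr-⊔ (sqDist z) _ X)

permute-flip : ∀ σ x → permute (flip σ) (permute σ x) ≡ x
permute-flip σ x = begin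
  tabulate (λ i → tabulate (λ j → x ‼ (σ ⟨$⟩ʳ j)) ‼ (σ ⟨$⟩ˡ i))
    ≡⟨ tabulate-cong (λ i → lookup∘tabulate (λ j → x ‼ (σ ⟨$⟩ʳ j)) (σ ⟨$⟩ˡ i)) ⟩
  tabulate (λ i → x ‼ (σ ⟨$⟩ʳ (σ ⟨$⟩ˡ i)))
    ≡⟨ tabulate-cong (λ i → cong (x ‼_) (inverseʳ σ {i})) ⟩
  tabulate (x ‼_)
    ≡⟨ tabulate∘lookup x ⟩
  x ∎
  where open ≡-Reasoning

_≟ₚ_ : DecidableEquality Pt
_≟ₚ_ = BooleanDecisions._≟ᵥ_ ℤ._≟_

permute-injective : ∀ σ {x y} → permute σ x ≡ permute σ y → x ≡ y
permute-injective σ {x} {y} eq = begin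
  x                               ≡⟨ permute-flip σ x ⟨
  permute (flip σ) (permute σ x) ≡⟨ cong (permute (flip σ)) eq ⟩
  permute (flip σ) (permute σ y) ≡⟨ permute-flip σ y ⟩
  y                               ∎
  where open ≡-Reasoning

mapsInto⇒isomorphic : ∀ σ {X E} {P : Pt → Set} → Unique X → length E ≤ length X →
                      All (λ x → permute σ x ∈ E) X →
                      (∀ {y} → P y → y ∈ E) → (∀ {y} → y ∈ E → P y) → Isomorphic X P
mapsInto⇒isomorphic σ {X} {E} uX |E|≤|X| X→E P⇒∈E ∈E⇒P = σ , λ x →
  (λ x∈X → ∈E⇒P (All.lookup X→E x∈X)) ,
  (λ p → preimage (E⊆σX (P⇒∈E p)))
  where
  σX = map (permute σ) X
  E⊆σX : E ⊆ σX
  E⊆σX = Unique-⊆-length≥⇒⊇ _≟ₚ_ (Unique.map⁺ (permute-injective σ) uX)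
                              (All.lookup (All.map⁺ {P = _∈ E} X→E))
                              (subst (length E ≤_) (sym (length-map _ X)) |E|≤|X|)
  preimage : ∀ {x} → permute σ x ∈ σX → x ∈ X
  preimage σx∈σX with ∈-map⁻ (permute σ) σx∈σX
  ... | x′ , x′∈X , σx≡σx′ = subst (_∈ X) (sym (permute-injective σ σx≡σx′)) x′∈X

open BooleanDecisions _≟ₚ_ using () renaming (_∈?_ to _∈ₚ?_)
open BooleanDecisions ℕ._≟_ using () renaming (_∈?_ to _∈ℕ?_)

data Extremal : Set where
  X₃ Y₃ Z₃ : Extremal

⟦_⟧ : Extremal → Pt → Set
⟦ X₃ ⟧ = X3
⟦ Y₃ ⟧ = Y3
⟦ Z₃ ⟧ = Z3

-- Integer literals are enabled only inside this module: enabled globally, every ℕ literal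
-- of the large tables below would go through instance resolution, which is slow.
module PointTables where

  open import Agda.Builtin.FromNat using (fromNat)
  open import Agda.Builtin.FromNeg using (fromNeg)

  instance
    ℤ-number = ℤLiterals.number
    ℤ-negative = ℤLiterals.negative

  -- L132 written out, so that lookups by label do not recompute the filter defining it.
  points : List Pt
  points =
    (1 ∷ 1 ∷ 0 ∷ 0 ∷ 0 ∷ -1 ∷ []) ∷
    (1 ∷ 0 ∷ 1 ∷ 0 ∷ 0 ∷ -1 ∷ []) ∷
    (0 ∷ 1 ∷ 1 ∷ 0 ∷ 0 ∷ -1 ∷ []) ∷
    (1 ∷ 0 ∷ 0 ∷ 1 ∷ 0 ∷ -1 ∷ []) ∷
    (0 ∷ 1 ∷ 0 ∷ 1 ∷ 0 ∷ -1 ∷ []) ∷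
    (0 ∷ 0 ∷ 1 ∷ 1 ∷ 0 ∷ -1 ∷ []) ∷
    (1 ∷ 0 ∷ 0 ∷ 0 ∷ 1 ∷ -1 ∷ []) ∷
    (0 ∷ 1 ∷ 0 ∷ 0 ∷ 1 ∷ -1 ∷ []) ∷
    (0 ∷ 0 ∷ 1 ∷ 0 ∷ 1 ∷ -1 ∷ []) ∷
    (0 ∷ 0 ∷ 0 ∷ 1 ∷ 1 ∷ -1 ∷ []) ∷
    (1 ∷ 1 ∷ 0 ∷ 0 ∷ -1 ∷ 0 ∷ []) ∷
    (1 ∷ 0 ∷ 1 ∷ 0 ∷ -1 ∷ 0 ∷ []) ∷
    (0 ∷ 1 ∷ 1 ∷ 0 ∷ -1 ∷ 0 ∷ []) ∷
    (1 ∷ 0 ∷ 0 ∷ 1 ∷ -1 ∷ 0 ∷ []) ∷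
    (0 ∷ 1 ∷ 0 ∷ 1 ∷ -1 ∷ 0 ∷ []) ∷
    (0 ∷ 0 ∷ 1 ∷ 1 ∷ -1 ∷ 0 ∷ []) ∷
    (1 ∷ 1 ∷ 0 ∷ -1 ∷ 0 ∷ 0 ∷ []) ∷
    (1 ∷ 0 ∷ 1 ∷ -1 ∷ 0 ∷ 0 ∷ []) ∷
    (0 ∷ 1 ∷ 1 ∷ -1 ∷ 0 ∷ 0 ∷ []) ∷
    (1 ∷ 1 ∷ -1 ∷ 0 ∷ 0 ∷ 0 ∷ []) ∷
    (1 ∷ -1 ∷ 1 ∷ 0 ∷ 0 ∷ 0 ∷ []) ∷
    (-1 ∷ 1 ∷ 1 ∷ 0 ∷ 0 ∷ 0 ∷ []) ∷
    (1 ∷ 0 ∷ -1 ∷ 1 ∷ 0 ∷ 0 ∷ []) ∷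
    (0 ∷ 1 ∷ -1 ∷ 1 ∷ 0 ∷ 0 ∷ []) ∷
    (1 ∷ -1 ∷ 0 ∷ 1 ∷ 0 ∷ 0 ∷ []) ∷
    (-1 ∷ 1 ∷ 0 ∷ 1 ∷ 0 ∷ 0 ∷ []) ∷
    (0 ∷ -1 ∷ 1 ∷ 1 ∷ 0 ∷ 0 ∷ []) ∷
    (-1 ∷ 0 ∷ 1 ∷ 1 ∷ 0 ∷ 0 ∷ []) ∷
    (1 ∷ 0 ∷ 0 ∷ -1 ∷ 1 ∷ 0 ∷ []) ∷
    (0 ∷ 1 ∷ 0 ∷ -1 ∷ 1 ∷ 0 ∷ []) ∷
    (0 ∷ 0 ∷ 1 ∷ -1 ∷ 1 ∷ 0 ∷ []) ∷
    (1 ∷ 0 ∷ -1 ∷ 0 ∷ 1 ∷ 0 ∷ []) ∷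
    (0 ∷ 1 ∷ -1 ∷ 0 ∷ 1 ∷ 0 ∷ []) ∷
    (1 ∷ -1 ∷ 0 ∷ 0 ∷ 1 ∷ 0 ∷ []) ∷
    (-1 ∷ 1 ∷ 0 ∷ 0 ∷ 1 ∷ 0 ∷ []) ∷
    (0 ∷ -1 ∷ 1 ∷ 0 ∷ 1 ∷ 0 ∷ []) ∷
    (-1 ∷ 0 ∷ 1 ∷ 0 ∷ 1 ∷ 0 ∷ []) ∷
    (0 ∷ 0 ∷ -1 ∷ 1 ∷ 1 ∷ 0 ∷ []) ∷
    (0 ∷ -1 ∷ 0 ∷ 1 ∷ 1 ∷ 0 ∷ []) ∷
    (-1 ∷ 0 ∷ 0 ∷ 1 ∷ 1 ∷ 0 ∷ []) ∷
    (1 ∷ 0 ∷ 0 ∷ 0 ∷ -1 ∷ 1 ∷ []) ∷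
    (0 ∷ 1 ∷ 0 ∷ 0 ∷ -1 ∷ 1 ∷ []) ∷
    (0 ∷ 0 ∷ 1 ∷ 0 ∷ -1 ∷ 1 ∷ []) ∷
    (0 ∷ 0 ∷ 0 ∷ 1 ∷ -1 ∷ 1 ∷ []) ∷
    (1 ∷ 0 ∷ 0 ∷ -1 ∷ 0 ∷ 1 ∷ []) ∷
    (0 ∷ 1 ∷ 0 ∷ -1 ∷ 0 ∷ 1 ∷ []) ∷
    (0 ∷ 0 ∷ 1 ∷ -1 ∷ 0 ∷ 1 ∷ []) ∷
    (1 ∷ 0 ∷ -1 ∷ 0 ∷ 0 ∷ 1 ∷ []) ∷
    (0 ∷ 1 ∷ -1 ∷ 0 ∷ 0 ∷ 1 ∷ []) ∷
    (1 ∷ -1 ∷ 0 ∷ 0 ∷ 0 ∷ 1 ∷ []) ∷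
    (-1 ∷ 1 ∷ 0 ∷ 0 ∷ 0 ∷ 1 ∷ []) ∷
    (0 ∷ -1 ∷ 1 ∷ 0 ∷ 0 ∷ 1 ∷ []) ∷
    (-1 ∷ 0 ∷ 1 ∷ 0 ∷ 0 ∷ 1 ∷ []) ∷
    (0 ∷ 0 ∷ -1 ∷ 1 ∷ 0 ∷ 1 ∷ []) ∷
    (0 ∷ -1 ∷ 0 ∷ 1 ∷ 0 ∷ 1 ∷ []) ∷
    (-1 ∷ 0 ∷ 0 ∷ 1 ∷ 0 ∷ 1 ∷ []) ∷
    (0 ∷ 0 ∷ 0 ∷ -1 ∷ 1 ∷ 1 ∷ []) ∷
    (0 ∷ 0 ∷ -1 ∷ 0 ∷ 1 ∷ 1 ∷ []) ∷
    (0 ∷ -1 ∷ 0 ∷ 0 ∷ 1 ∷ 1 ∷ []) ∷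
    (-1 ∷ 0 ∷ 0 ∷ 0 ∷ 1 ∷ 1 ∷ []) ∷ []

  elements : Extremal → List Pt
  elements X₃ =
    (0 ∷ 0 ∷ 0 ∷ 1 ∷ 1 ∷ -1 ∷ []) ∷
    (-1 ∷ 1 ∷ 1 ∷ 0 ∷ 0 ∷ 0 ∷ []) ∷
    (-1 ∷ 1 ∷ 0 ∷ 1 ∷ 0 ∷ 0 ∷ []) ∷
    (0 ∷ -1 ∷ 1 ∷ 1 ∷ 0 ∷ 0 ∷ []) ∷
    (-1 ∷ 0 ∷ 1 ∷ 1 ∷ 0 ∷ 0 ∷ []) ∷
    (-1 ∷ 1 ∷ 0 ∷ 0 ∷ 1 ∷ 0 ∷ []) ∷
    (0 ∷ -1 ∷ 1 ∷ 0 ∷ 1 ∷ 0 ∷ []) ∷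
    (-1 ∷ 0 ∷ 1 ∷ 0 ∷ 1 ∷ 0 ∷ []) ∷
    (0 ∷ 0 ∷ -1 ∷ 1 ∷ 1 ∷ 0 ∷ []) ∷
    (0 ∷ -1 ∷ 0 ∷ 1 ∷ 1 ∷ 0 ∷ []) ∷
    (-1 ∷ 0 ∷ 0 ∷ 1 ∷ 1 ∷ 0 ∷ []) ∷
    (0 ∷ 0 ∷ 0 ∷ 1 ∷ -1 ∷ 1 ∷ []) ∷
    (-1 ∷ 1 ∷ 0 ∷ 0 ∷ 0 ∷ 1 ∷ []) ∷
    (0 ∷ -1 ∷ 1 ∷ 0 ∷ 0 ∷ 1 ∷ []) ∷
    (-1 ∷ 0 ∷ 1 ∷ 0 ∷ 0 ∷ 1 ∷ []) ∷
    (0 ∷ 0 ∷ -1 ∷ 1 ∷ 0 ∷ 1 ∷ []) ∷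
    (0 ∷ -1 ∷ 0 ∷ 1 ∷ 0 ∷ 1 ∷ []) ∷
    (-1 ∷ 0 ∷ 0 ∷ 1 ∷ 0 ∷ 1 ∷ []) ∷
    (0 ∷ 0 ∷ 0 ∷ -1 ∷ 1 ∷ 1 ∷ []) ∷
    (0 ∷ 0 ∷ -1 ∷ 0 ∷ 1 ∷ 1 ∷ []) ∷
    (0 ∷ -1 ∷ 0 ∷ 0 ∷ 1 ∷ 1 ∷ []) ∷
    (-1 ∷ 0 ∷ 0 ∷ 0 ∷ 1 ∷ 1 ∷ []) ∷ []
  elements Y₃ =
    (0 ∷ 0 ∷ 1 ∷ 1 ∷ 0 ∷ -1 ∷ []) ∷
    (0 ∷ 0 ∷ 1 ∷ 0 ∷ 1 ∷ -1 ∷ []) ∷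
    (0 ∷ 0 ∷ 1 ∷ 1 ∷ -1 ∷ 0 ∷ []) ∷
    (-1 ∷ 1 ∷ 1 ∷ 0 ∷ 0 ∷ 0 ∷ []) ∷
    (-1 ∷ 1 ∷ 0 ∷ 1 ∷ 0 ∷ 0 ∷ []) ∷
    (0 ∷ -1 ∷ 1 ∷ 1 ∷ 0 ∷ 0 ∷ []) ∷
    (-1 ∷ 0 ∷ 1 ∷ 1 ∷ 0 ∷ 0 ∷ []) ∷
    (0 ∷ 0 ∷ 1 ∷ -1 ∷ 1 ∷ 0 ∷ []) ∷
    (-1 ∷ 1 ∷ 0 ∷ 0 ∷ 1 ∷ 0 ∷ []) ∷
    (0 ∷ -1 ∷ 1 ∷ 0 ∷ 1 ∷ 0 ∷ []) ∷
    (-1 ∷ 0 ∷ 1 ∷ 0 ∷ 1 ∷ 0 ∷ []) ∷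
    (0 ∷ -1 ∷ 0 ∷ 1 ∷ 1 ∷ 0 ∷ []) ∷
    (-1 ∷ 0 ∷ 0 ∷ 1 ∷ 1 ∷ 0 ∷ []) ∷
    (0 ∷ 0 ∷ 1 ∷ 0 ∷ -1 ∷ 1 ∷ []) ∷
    (0 ∷ 0 ∷ 1 ∷ -1 ∷ 0 ∷ 1 ∷ []) ∷
    (-1 ∷ 1 ∷ 0 ∷ 0 ∷ 0 ∷ 1 ∷ []) ∷
    (0 ∷ -1 ∷ 1 ∷ 0 ∷ 0 ∷ 1 ∷ []) ∷
    (-1 ∷ 0 ∷ 1 ∷ 0 ∷ 0 ∷ 1 ∷ []) ∷
    (0 ∷ -1 ∷ 0 ∷ 1 ∷ 0 ∷ 1 ∷ []) ∷
    (-1 ∷ 0 ∷ 0 ∷ 1 ∷ 0 ∷ 1 ∷ []) ∷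
    (0 ∷ -1 ∷ 0 ∷ 0 ∷ 1 ∷ 1 ∷ []) ∷
    (-1 ∷ 0 ∷ 0 ∷ 0 ∷ 1 ∷ 1 ∷ []) ∷ []
  elements Z₃ =
    (0 ∷ 1 ∷ 1 ∷ 0 ∷ 0 ∷ -1 ∷ []) ∷
    (0 ∷ 1 ∷ 0 ∷ 1 ∷ 0 ∷ -1 ∷ []) ∷
    (0 ∷ 1 ∷ 0 ∷ 0 ∷ 1 ∷ -1 ∷ []) ∷
    (0 ∷ 1 ∷ 1 ∷ 0 ∷ -1 ∷ 0 ∷ []) ∷
    (0 ∷ 1 ∷ 0 ∷ 1 ∷ -1 ∷ 0 ∷ []) ∷
    (0 ∷ 1 ∷ 1 ∷ -1 ∷ 0 ∷ 0 ∷ []) ∷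
    (-1 ∷ 1 ∷ 1 ∷ 0 ∷ 0 ∷ 0 ∷ []) ∷
    (0 ∷ 1 ∷ -1 ∷ 1 ∷ 0 ∷ 0 ∷ []) ∷
    (-1 ∷ 1 ∷ 0 ∷ 1 ∷ 0 ∷ 0 ∷ []) ∷
    (-1 ∷ 0 ∷ 1 ∷ 1 ∷ 0 ∷ 0 ∷ []) ∷
    (0 ∷ 1 ∷ 0 ∷ -1 ∷ 1 ∷ 0 ∷ []) ∷
    (0 ∷ 1 ∷ -1 ∷ 0 ∷ 1 ∷ 0 ∷ []) ∷
    (-1 ∷ 1 ∷ 0 ∷ 0 ∷ 1 ∷ 0 ∷ []) ∷
    (-1 ∷ 0 ∷ 1 ∷ 0 ∷ 1 ∷ 0 ∷ []) ∷
    (-1 ∷ 0 ∷ 0 ∷ 1 ∷ 1 ∷ 0 ∷ []) ∷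
    (0 ∷ 1 ∷ 0 ∷ 0 ∷ -1 ∷ 1 ∷ []) ∷
    (0 ∷ 1 ∷ 0 ∷ -1 ∷ 0 ∷ 1 ∷ []) ∷
    (0 ∷ 1 ∷ -1 ∷ 0 ∷ 0 ∷ 1 ∷ []) ∷
    (-1 ∷ 1 ∷ 0 ∷ 0 ∷ 0 ∷ 1 ∷ []) ∷
    (-1 ∷ 0 ∷ 1 ∷ 0 ∷ 0 ∷ 1 ∷ []) ∷
    (-1 ∷ 0 ∷ 0 ∷ 1 ∷ 0 ∷ 1 ∷ []) ∷
    (-1 ∷ 0 ∷ 0 ∷ 0 ∷ 1 ∷ 1 ∷ []) ∷ []

open PointTables using (points; elements)

L132≡points : L132 ≡ points
L132≡points = refl

point : ℕ → Pt
point = nth (replicate 6 (+ 0)) points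

label : Pt → ℕ
label = indexOf _≟ₚ_ points

point-label : ∀ {x} → x ∈ L132 → point (label x) ≡ x
point-label {x} x∈L = nth-indexOf _≟ₚ_ (replicate 6 (+ 0)) points (subst (x ∈_) L132≡points x∈L)

-- Entry a lists the labels of the points at squared distance 10 = diamSq L132 from point a.
diametral : List (List ℕ)
diametral =
  (51 ∷ 52 ∷ 54 ∷ 55 ∷ 58 ∷ 59 ∷ []) ∷
  (48 ∷ 50 ∷ 53 ∷ 55 ∷ 57 ∷ 59 ∷ []) ∷
  (47 ∷ 49 ∷ 53 ∷ 54 ∷ 57 ∷ 58 ∷ []) ∷
  (45 ∷ 46 ∷ 50 ∷ 52 ∷ 56 ∷ 59 ∷ []) ∷
  (44 ∷ 46 ∷ 49 ∷ 51 ∷ 56 ∷ 58 ∷ []) ∷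
  (44 ∷ 45 ∷ 47 ∷ 48 ∷ 56 ∷ 57 ∷ []) ∷
  (41 ∷ 42 ∷ 43 ∷ 50 ∷ 52 ∷ 55 ∷ []) ∷
  (40 ∷ 42 ∷ 43 ∷ 49 ∷ 51 ∷ 54 ∷ []) ∷
  (40 ∷ 41 ∷ 43 ∷ 47 ∷ 48 ∷ 53 ∷ []) ∷
  (40 ∷ 41 ∷ 42 ∷ 44 ∷ 45 ∷ 46 ∷ []) ∷
  (35 ∷ 36 ∷ 38 ∷ 39 ∷ 58 ∷ 59 ∷ []) ∷
  (32 ∷ 34 ∷ 37 ∷ 39 ∷ 57 ∷ 59 ∷ []) ∷
  (31 ∷ 33 ∷ 37 ∷ 38 ∷ 57 ∷ 58 ∷ []) ∷
  (29 ∷ 30 ∷ 34 ∷ 36 ∷ 56 ∷ 59 ∷ []) ∷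
  (28 ∷ 30 ∷ 33 ∷ 35 ∷ 56 ∷ 58 ∷ []) ∷
  (28 ∷ 29 ∷ 31 ∷ 32 ∷ 56 ∷ 57 ∷ []) ∷
  (26 ∷ 27 ∷ 38 ∷ 39 ∷ 54 ∷ 55 ∷ []) ∷
  (23 ∷ 25 ∷ 37 ∷ 39 ∷ 53 ∷ 55 ∷ []) ∷
  (22 ∷ 24 ∷ 37 ∷ 38 ∷ 53 ∷ 54 ∷ []) ∷
  (26 ∷ 27 ∷ 35 ∷ 36 ∷ 51 ∷ 52 ∷ []) ∷
  (23 ∷ 25 ∷ 32 ∷ 34 ∷ 48 ∷ 50 ∷ []) ∷
  (22 ∷ 24 ∷ 31 ∷ 33 ∷ 47 ∷ 49 ∷ []) ∷
  (18 ∷ 21 ∷ 30 ∷ 36 ∷ 46 ∷ 52 ∷ []) ∷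
  (17 ∷ 20 ∷ 30 ∷ 35 ∷ 46 ∷ 51 ∷ []) ∷
  (18 ∷ 21 ∷ 29 ∷ 34 ∷ 45 ∷ 50 ∷ []) ∷
  (17 ∷ 20 ∷ 28 ∷ 33 ∷ 44 ∷ 49 ∷ []) ∷
  (16 ∷ 19 ∷ 29 ∷ 32 ∷ 45 ∷ 48 ∷ []) ∷
  (16 ∷ 19 ∷ 28 ∷ 31 ∷ 44 ∷ 47 ∷ []) ∷
  (14 ∷ 15 ∷ 25 ∷ 27 ∷ 43 ∷ 55 ∷ []) ∷
  (13 ∷ 15 ∷ 24 ∷ 26 ∷ 43 ∷ 54 ∷ []) ∷
  (13 ∷ 14 ∷ 22 ∷ 23 ∷ 43 ∷ 53 ∷ []) ∷
  (12 ∷ 15 ∷ 21 ∷ 27 ∷ 42 ∷ 52 ∷ []) ∷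
  (11 ∷ 15 ∷ 20 ∷ 26 ∷ 42 ∷ 51 ∷ []) ∷
  (12 ∷ 14 ∷ 21 ∷ 25 ∷ 41 ∷ 50 ∷ []) ∷
  (11 ∷ 13 ∷ 20 ∷ 24 ∷ 40 ∷ 49 ∷ []) ∷
  (10 ∷ 14 ∷ 19 ∷ 23 ∷ 41 ∷ 48 ∷ []) ∷
  (10 ∷ 13 ∷ 19 ∷ 22 ∷ 40 ∷ 47 ∷ []) ∷
  (11 ∷ 12 ∷ 17 ∷ 18 ∷ 42 ∷ 46 ∷ []) ∷
  (10 ∷ 12 ∷ 16 ∷ 18 ∷ 41 ∷ 45 ∷ []) ∷
  (10 ∷ 11 ∷ 16 ∷ 17 ∷ 40 ∷ 44 ∷ []) ∷
  (7 ∷ 8 ∷ 9 ∷ 34 ∷ 36 ∷ 39 ∷ []) ∷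
  (6 ∷ 8 ∷ 9 ∷ 33 ∷ 35 ∷ 38 ∷ []) ∷
  (6 ∷ 7 ∷ 9 ∷ 31 ∷ 32 ∷ 37 ∷ []) ∷
  (6 ∷ 7 ∷ 8 ∷ 28 ∷ 29 ∷ 30 ∷ []) ∷
  (4 ∷ 5 ∷ 9 ∷ 25 ∷ 27 ∷ 39 ∷ []) ∷
  (3 ∷ 5 ∷ 9 ∷ 24 ∷ 26 ∷ 38 ∷ []) ∷
  (3 ∷ 4 ∷ 9 ∷ 22 ∷ 23 ∷ 37 ∷ []) ∷
  (2 ∷ 5 ∷ 8 ∷ 21 ∷ 27 ∷ 36 ∷ []) ∷
  (1 ∷ 5 ∷ 8 ∷ 20 ∷ 26 ∷ 35 ∷ []) ∷
  (2 ∷ 4 ∷ 7 ∷ 21 ∷ 25 ∷ 34 ∷ []) ∷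
  (1 ∷ 3 ∷ 6 ∷ 20 ∷ 24 ∷ 33 ∷ []) ∷
  (0 ∷ 4 ∷ 7 ∷ 19 ∷ 23 ∷ 32 ∷ []) ∷
  (0 ∷ 3 ∷ 6 ∷ 19 ∷ 22 ∷ 31 ∷ []) ∷
  (1 ∷ 2 ∷ 8 ∷ 17 ∷ 18 ∷ 30 ∷ []) ∷
  (0 ∷ 2 ∷ 7 ∷ 16 ∷ 18 ∷ 29 ∷ []) ∷
  (0 ∷ 1 ∷ 6 ∷ 16 ∷ 17 ∷ 28 ∷ []) ∷
  (3 ∷ 4 ∷ 5 ∷ 13 ∷ 14 ∷ 15 ∷ []) ∷
  (1 ∷ 2 ∷ 5 ∷ 11 ∷ 12 ∷ 15 ∷ []) ∷
  (0 ∷ 2 ∷ 4 ∷ 10 ∷ 12 ∷ 14 ∷ []) ∷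
  (0 ∷ 1 ∷ 3 ∷ 10 ∷ 11 ∷ 13 ∷ []) ∷ []

_⇹_ : ℕ → ℕ → Set
a ⇹ b = b ∈ nth [] diametral a

open IndependentSets ℕ._≟_ {_~_ = _⇹_} (λ a b → b ∈ℕ? nth [] diametral a)

-- An ordering of the labels that keeps the search tree small.
searchOrder : List ℕ
searchOrder =
  26 ∷ 18 ∷ 51 ∷ 9 ∷ 10 ∷ 34 ∷ 8 ∷ 17 ∷ 14 ∷ 48 ∷ 0 ∷ 49 ∷ 6 ∷ 35 ∷ 4 ∷ 30 ∷ 23 ∷ 40 ∷ 39 ∷ 41 ∷
  13 ∷ 46 ∷ 38 ∷ 16 ∷ 25 ∷ 43 ∷ 37 ∷ 20 ∷ 32 ∷ 59 ∷ 52 ∷ 19 ∷ 56 ∷ 11 ∷ 3 ∷ 15 ∷ 36 ∷ 21 ∷ 28 ∷ 22 ∷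
  24 ∷ 45 ∷ 29 ∷ 55 ∷ 57 ∷ 1 ∷ 54 ∷ 42 ∷ 31 ∷ 7 ∷ 27 ∷ 5 ∷ 12 ∷ 58 ∷ 33 ∷ 44 ∷ 50 ∷ 47 ∷ 2 ∷ 53 ∷ []

diamSq-L132 : diamSq L132 ≡ + 10
diamSq-L132 = refl

diametral-sound : All (λ x → All (λ b → sqDist x (point b) ≡ + 10) (nth [] diametral (label x))) L132
diametral-sound =
  toWitness {a? = All.all? (λ x → All.all? (λ b → sqDist x (point b) ℤ.≟ + 10) _) L132} tt

label∈searchOrder : All (λ x → label x ∈ searchOrder) L132
label∈searchOrder = toWitness {a? = All.all? (λ x → label x ∈ℕ? searchOrder) L132} tt

module _ {X : List Pt} (X⊆L : All (_∈ L132) X) where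

  point∘label : map point (map label X) ≡ X
  point∘label = trans (sym (map-∘ X)) (map-id-local (All.map point-label X⊆L))

  labels-unique : Unique X → Unique (map label X)
  labels-unique uX = Unique.map⁻ (subst Unique (sym point∘label) uX)

  labels⊆searchOrder : map label X ⊆ searchOrder
  labels⊆searchOrder a∈ with ∈-map⁻ label a∈
  ... | x , x∈X , refl = All.lookup label∈searchOrder (All.lookup X⊆L x∈X)

  labels-independent : diamSq X < diamSq L132 → Independent (map label X)
  labels-independent diam< a∈ b∈ a⇹b with ∈-map⁻ label a∈ | ∈-map⁻ label b∈
  ... | x , x∈X , refl | y , y∈X , refl =
    ℤ.<-irrefl refl (ℤ.≤-<-trans 10≤diamSq (subst (diamSq X <_) diamSq-L132 diam<))
    where
    sqDist≡10 : sqDist x y ≡ + 10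
    sqDist≡10 = subst (λ z → sqDist x z ≡ + 10) (point-label (All.lookup X⊆L y∈X))
                      (All.lookup (All.lookup diametral-sound (All.lookup X⊆L x∈X)) a⇹b)
    10≤diamSq : + 10 ≤ℤ diamSq X
    10≤diamSq = subst (_≤ℤ diamSq X) sqDist≡10 (sqDist≤diamSq x∈X y∈X)

independent⇒length≤22 : ∀ {I} → Unique I → Independent I → I ⊆ searchOrder → length I ≤ 22
independent⇒length≤22 uI indI I⊆ = s≤s⁻¹ (independentSets≡[]⇒length< 23 searchOrder refl uI indI I⊆)

⟦⟧⊆L132 : ∀ e {y} → ⟦ e ⟧ y → y ∈ L132
⟦⟧⊆L132 X₃ = [ proj₁ , [ proj₁ , [ proj₁ , [ proj₁ , proj₁ ]′ ]′ ]′ ]′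
⟦⟧⊆L132 Y₃ = [ proj₁ , [ proj₁ , proj₁ ]′ ]′
⟦⟧⊆L132 Z₃ = [ proj₁ , proj₁ ]′

-- Decided on the literal list: membership in L132 itself would recompute the filter defining it.
_∈L132? : Decidable (_∈ L132)
y ∈L132? = subst (Dec ∘ (y ∈_)) (sym L132≡points) (y ∈ₚ? points)

zerosBefore? : ∀ (i : Fin 6) (y : Pt) → Dec (∀ j → toℕ j <ℕ toℕ i → y ‼ j ≡ + 0)
zerosBefore? i y = Fin.all? (λ j → toℕ j ℕ.<? toℕ i →-dec y ‼ j ℤ.≟ + 0)

S3? : ∀ i → Decidable (S3 i)
S3? i y = y ∈L132? ×-dec zerosBefore? i y ×-dec y ‼ i ℤ.≟ -[1+ 0 ]

T3? : ∀ i → Decidable (T3 i)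
T3? i y = y ∈L132? ×-dec zerosBefore? i y ×-dec y ‼ i ℤ.≟ + 1

⟦_⟧? : ∀ e → Decidable ⟦ e ⟧
⟦ X₃ ⟧? y = T3? 3F y ⊎-dec S3? 0F y ⊎-dec S3? 1F y ⊎-dec S3? 2F y ⊎-dec S3? 3F y
⟦ Y₃ ⟧? y = T3? 2F y ⊎-dec S3? 0F y ⊎-dec S3? 1F y
⟦ Z₃ ⟧? y = T3? 1F y ⊎-dec S3? 0F y

filter-⟦⟧ : ∀ e → filter ⟦ e ⟧? L132 ≡ elements e
filter-⟦⟧ X₃ = refl
filter-⟦⟧ Y₃ = refl
filter-⟦⟧ Z₃ = refl

length-elements : ∀ e → length (elements e) ≡ 22
length-elements X₃ = refl
length-elements Y₃ = refl
length-elements Z₃ = refl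

⟦⟧⇒∈elements : ∀ e {y} → ⟦ e ⟧ y → y ∈ elements e
⟦⟧⇒∈elements e p = subst (_ ∈_) (filter-⟦⟧ e) (∈-filter⁺ ⟦ e ⟧? (⟦⟧⊆L132 e p) p)

∈elements⇒⟦⟧ : ∀ e {y} → y ∈ elements e → ⟦ e ⟧ y
∈elements⇒⟦⟧ e y∈ = proj₂ (∈-filter⁻ ⟦ e ⟧? (subst (_ ∈_) (sym (filter-⟦⟧ e)) y∈))

independent22Sets : List (List ℕ)
independent22Sets =
  (26 ∷ 18 ∷ 51 ∷ 10 ∷ 17 ∷ 14 ∷ 40 ∷ 41 ∷ 13 ∷ 46 ∷ 43 ∷ 20 ∷ 52 ∷ 11 ∷ 15 ∷ 21 ∷ 1 ∷ 42 ∷ 27 ∷ 5 ∷ 12 ∷ 2 ∷ []) ∷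
  (26 ∷ 18 ∷ 51 ∷ 10 ∷ 14 ∷ 40 ∷ 41 ∷ 13 ∷ 46 ∷ 25 ∷ 43 ∷ 52 ∷ 11 ∷ 15 ∷ 21 ∷ 55 ∷ 42 ∷ 27 ∷ 5 ∷ 12 ∷ 50 ∷ 2 ∷ []) ∷
  (26 ∷ 18 ∷ 51 ∷ 34 ∷ 8 ∷ 35 ∷ 30 ∷ 39 ∷ 46 ∷ 25 ∷ 59 ∷ 52 ∷ 15 ∷ 36 ∷ 21 ∷ 55 ∷ 42 ∷ 27 ∷ 5 ∷ 12 ∷ 50 ∷ 2 ∷ []) ∷
  (26 ∷ 18 ∷ 51 ∷ 34 ∷ 14 ∷ 39 ∷ 41 ∷ 46 ∷ 25 ∷ 43 ∷ 59 ∷ 52 ∷ 15 ∷ 36 ∷ 21 ∷ 55 ∷ 42 ∷ 27 ∷ 5 ∷ 12 ∷ 50 ∷ 2 ∷ []) ∷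
  (26 ∷ 18 ∷ 9 ∷ 10 ∷ 8 ∷ 17 ∷ 14 ∷ 0 ∷ 6 ∷ 4 ∷ 13 ∷ 20 ∷ 11 ∷ 3 ∷ 15 ∷ 21 ∷ 1 ∷ 7 ∷ 27 ∷ 5 ∷ 12 ∷ 2 ∷ []) ∷
  (26 ∷ 18 ∷ 9 ∷ 10 ∷ 8 ∷ 14 ∷ 0 ∷ 6 ∷ 4 ∷ 23 ∷ 13 ∷ 25 ∷ 11 ∷ 3 ∷ 15 ∷ 21 ∷ 1 ∷ 7 ∷ 27 ∷ 5 ∷ 12 ∷ 2 ∷ []) ∷
  (26 ∷ 18 ∷ 9 ∷ 34 ∷ 8 ∷ 14 ∷ 0 ∷ 6 ∷ 4 ∷ 23 ∷ 39 ∷ 25 ∷ 3 ∷ 15 ∷ 36 ∷ 21 ∷ 1 ∷ 7 ∷ 27 ∷ 5 ∷ 12 ∷ 2 ∷ []) ∷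
  (26 ∷ 18 ∷ 9 ∷ 34 ∷ 8 ∷ 14 ∷ 4 ∷ 23 ∷ 39 ∷ 25 ∷ 59 ∷ 52 ∷ 15 ∷ 36 ∷ 21 ∷ 55 ∷ 7 ∷ 27 ∷ 5 ∷ 12 ∷ 50 ∷ 2 ∷ []) ∷
  (26 ∷ 18 ∷ 9 ∷ 34 ∷ 8 ∷ 0 ∷ 6 ∷ 35 ∷ 4 ∷ 30 ∷ 39 ∷ 25 ∷ 3 ∷ 15 ∷ 36 ∷ 21 ∷ 1 ∷ 7 ∷ 27 ∷ 5 ∷ 12 ∷ 2 ∷ []) ∷
  (26 ∷ 18 ∷ 9 ∷ 34 ∷ 8 ∷ 35 ∷ 4 ∷ 30 ∷ 39 ∷ 25 ∷ 59 ∷ 52 ∷ 15 ∷ 36 ∷ 21 ∷ 55 ∷ 7 ∷ 27 ∷ 5 ∷ 12 ∷ 50 ∷ 2 ∷ []) ∷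
  (26 ∷ 18 ∷ 9 ∷ 8 ∷ 17 ∷ 0 ∷ 6 ∷ 35 ∷ 4 ∷ 30 ∷ 20 ∷ 11 ∷ 3 ∷ 15 ∷ 36 ∷ 21 ∷ 1 ∷ 7 ∷ 27 ∷ 5 ∷ 12 ∷ 2 ∷ []) ∷
  (26 ∷ 18 ∷ 10 ∷ 17 ∷ 14 ∷ 0 ∷ 4 ∷ 40 ∷ 41 ∷ 13 ∷ 43 ∷ 20 ∷ 11 ∷ 3 ∷ 15 ∷ 21 ∷ 1 ∷ 42 ∷ 27 ∷ 5 ∷ 12 ∷ 2 ∷ []) ∷
  (26 ∷ 18 ∷ 10 ∷ 14 ∷ 0 ∷ 4 ∷ 23 ∷ 40 ∷ 41 ∷ 13 ∷ 25 ∷ 43 ∷ 11 ∷ 3 ∷ 15 ∷ 21 ∷ 1 ∷ 42 ∷ 27 ∷ 5 ∷ 12 ∷ 2 ∷ []) ∷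
  (26 ∷ 18 ∷ 10 ∷ 14 ∷ 4 ∷ 23 ∷ 40 ∷ 41 ∷ 13 ∷ 25 ∷ 43 ∷ 52 ∷ 11 ∷ 15 ∷ 21 ∷ 55 ∷ 42 ∷ 27 ∷ 5 ∷ 12 ∷ 50 ∷ 2 ∷ []) ∷
  (26 ∷ 18 ∷ 34 ∷ 14 ∷ 4 ∷ 23 ∷ 39 ∷ 41 ∷ 25 ∷ 43 ∷ 59 ∷ 52 ∷ 15 ∷ 36 ∷ 21 ∷ 55 ∷ 42 ∷ 27 ∷ 5 ∷ 12 ∷ 50 ∷ 2 ∷ []) ∷
  (26 ∷ 51 ∷ 9 ∷ 34 ∷ 8 ∷ 35 ∷ 30 ∷ 39 ∷ 38 ∷ 25 ∷ 37 ∷ 59 ∷ 52 ∷ 56 ∷ 36 ∷ 21 ∷ 55 ∷ 57 ∷ 54 ∷ 27 ∷ 58 ∷ 50 ∷ []) ∷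
  (26 ∷ 51 ∷ 9 ∷ 34 ∷ 8 ∷ 35 ∷ 30 ∷ 39 ∷ 38 ∷ 25 ∷ 37 ∷ 59 ∷ 52 ∷ 15 ∷ 36 ∷ 21 ∷ 55 ∷ 54 ∷ 27 ∷ 5 ∷ 58 ∷ 50 ∷ []) ∷
  (26 ∷ 51 ∷ 9 ∷ 34 ∷ 35 ∷ 39 ∷ 38 ∷ 25 ∷ 43 ∷ 37 ∷ 59 ∷ 52 ∷ 56 ∷ 36 ∷ 21 ∷ 55 ∷ 57 ∷ 54 ∷ 27 ∷ 58 ∷ 50 ∷ 53 ∷ []) ∷
  (26 ∷ 51 ∷ 9 ∷ 34 ∷ 35 ∷ 39 ∷ 38 ∷ 25 ∷ 43 ∷ 37 ∷ 59 ∷ 52 ∷ 15 ∷ 36 ∷ 21 ∷ 55 ∷ 54 ∷ 27 ∷ 5 ∷ 58 ∷ 50 ∷ 53 ∷ []) ∷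
  (26 ∷ 51 ∷ 9 ∷ 8 ∷ 17 ∷ 49 ∷ 6 ∷ 35 ∷ 30 ∷ 38 ∷ 20 ∷ 11 ∷ 3 ∷ 15 ∷ 36 ∷ 24 ∷ 1 ∷ 54 ∷ 27 ∷ 5 ∷ 58 ∷ 33 ∷ []) ∷
  (26 ∷ 51 ∷ 9 ∷ 8 ∷ 17 ∷ 49 ∷ 6 ∷ 35 ∷ 30 ∷ 38 ∷ 20 ∷ 11 ∷ 3 ∷ 36 ∷ 28 ∷ 24 ∷ 1 ∷ 54 ∷ 31 ∷ 5 ∷ 58 ∷ 33 ∷ []) ∷
  (26 ∷ 51 ∷ 9 ∷ 8 ∷ 17 ∷ 49 ∷ 6 ∷ 35 ∷ 13 ∷ 38 ∷ 20 ∷ 11 ∷ 3 ∷ 15 ∷ 22 ∷ 24 ∷ 1 ∷ 54 ∷ 27 ∷ 5 ∷ 58 ∷ 33 ∷ []) ∷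
  (26 ∷ 51 ∷ 9 ∷ 8 ∷ 17 ∷ 49 ∷ 6 ∷ 35 ∷ 13 ∷ 38 ∷ 20 ∷ 11 ∷ 3 ∷ 28 ∷ 22 ∷ 24 ∷ 1 ∷ 54 ∷ 31 ∷ 5 ∷ 58 ∷ 33 ∷ []) ∷
  (26 ∷ 51 ∷ 9 ∷ 8 ∷ 49 ∷ 6 ∷ 35 ∷ 30 ∷ 39 ∷ 38 ∷ 37 ∷ 20 ∷ 59 ∷ 56 ∷ 36 ∷ 28 ∷ 24 ∷ 57 ∷ 54 ∷ 31 ∷ 58 ∷ 33 ∷ []) ∷
  (26 ∷ 51 ∷ 9 ∷ 8 ∷ 49 ∷ 6 ∷ 35 ∷ 30 ∷ 39 ∷ 38 ∷ 37 ∷ 20 ∷ 3 ∷ 15 ∷ 36 ∷ 24 ∷ 1 ∷ 54 ∷ 27 ∷ 5 ∷ 58 ∷ 33 ∷ []) ∷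
  (26 ∷ 51 ∷ 9 ∷ 8 ∷ 49 ∷ 6 ∷ 35 ∷ 30 ∷ 39 ∷ 38 ∷ 37 ∷ 20 ∷ 3 ∷ 36 ∷ 28 ∷ 24 ∷ 1 ∷ 54 ∷ 31 ∷ 5 ∷ 58 ∷ 33 ∷ []) ∷
  (26 ∷ 51 ∷ 9 ∷ 8 ∷ 49 ∷ 6 ∷ 35 ∷ 39 ∷ 13 ∷ 38 ∷ 37 ∷ 20 ∷ 3 ∷ 15 ∷ 22 ∷ 24 ∷ 1 ∷ 54 ∷ 27 ∷ 5 ∷ 58 ∷ 33 ∷ []) ∷
  (26 ∷ 51 ∷ 9 ∷ 8 ∷ 49 ∷ 6 ∷ 35 ∷ 39 ∷ 13 ∷ 38 ∷ 37 ∷ 20 ∷ 3 ∷ 28 ∷ 22 ∷ 24 ∷ 1 ∷ 54 ∷ 31 ∷ 5 ∷ 58 ∷ 33 ∷ []) ∷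
  (26 ∷ 51 ∷ 9 ∷ 8 ∷ 49 ∷ 35 ∷ 30 ∷ 39 ∷ 38 ∷ 37 ∷ 20 ∷ 59 ∷ 52 ∷ 56 ∷ 36 ∷ 24 ∷ 55 ∷ 57 ∷ 54 ∷ 27 ∷ 58 ∷ 33 ∷ []) ∷
  (26 ∷ 51 ∷ 9 ∷ 8 ∷ 49 ∷ 35 ∷ 30 ∷ 39 ∷ 38 ∷ 37 ∷ 20 ∷ 59 ∷ 52 ∷ 15 ∷ 36 ∷ 24 ∷ 55 ∷ 54 ∷ 27 ∷ 5 ∷ 58 ∷ 33 ∷ []) ∷
  (26 ∷ 51 ∷ 9 ∷ 49 ∷ 6 ∷ 35 ∷ 39 ∷ 13 ∷ 38 ∷ 37 ∷ 20 ∷ 3 ∷ 28 ∷ 22 ∷ 24 ∷ 57 ∷ 54 ∷ 31 ∷ 58 ∷ 33 ∷ 47 ∷ 53 ∷ []) ∷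
  (26 ∷ 51 ∷ 9 ∷ 49 ∷ 6 ∷ 35 ∷ 39 ∷ 38 ∷ 37 ∷ 20 ∷ 59 ∷ 56 ∷ 28 ∷ 22 ∷ 24 ∷ 57 ∷ 54 ∷ 31 ∷ 58 ∷ 33 ∷ 47 ∷ 53 ∷ []) ∷
  (26 ∷ 51 ∷ 9 ∷ 49 ∷ 35 ∷ 39 ∷ 13 ∷ 38 ∷ 43 ∷ 37 ∷ 20 ∷ 3 ∷ 15 ∷ 22 ∷ 24 ∷ 55 ∷ 54 ∷ 27 ∷ 5 ∷ 58 ∷ 33 ∷ 53 ∷ []) ∷
  (26 ∷ 51 ∷ 9 ∷ 49 ∷ 35 ∷ 39 ∷ 13 ∷ 38 ∷ 43 ∷ 37 ∷ 20 ∷ 3 ∷ 22 ∷ 24 ∷ 55 ∷ 57 ∷ 54 ∷ 31 ∷ 58 ∷ 33 ∷ 47 ∷ 53 ∷ []) ∷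
  (26 ∷ 51 ∷ 9 ∷ 49 ∷ 35 ∷ 39 ∷ 38 ∷ 43 ∷ 37 ∷ 20 ∷ 59 ∷ 52 ∷ 56 ∷ 36 ∷ 24 ∷ 55 ∷ 57 ∷ 54 ∷ 27 ∷ 58 ∷ 33 ∷ 53 ∷ []) ∷
  (26 ∷ 51 ∷ 9 ∷ 49 ∷ 35 ∷ 39 ∷ 38 ∷ 43 ∷ 37 ∷ 20 ∷ 59 ∷ 52 ∷ 15 ∷ 36 ∷ 24 ∷ 55 ∷ 54 ∷ 27 ∷ 5 ∷ 58 ∷ 33 ∷ 53 ∷ []) ∷
  (26 ∷ 51 ∷ 9 ∷ 49 ∷ 35 ∷ 39 ∷ 38 ∷ 43 ∷ 37 ∷ 20 ∷ 59 ∷ 56 ∷ 22 ∷ 24 ∷ 55 ∷ 57 ∷ 54 ∷ 31 ∷ 58 ∷ 33 ∷ 47 ∷ 53 ∷ []) ∷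
  (26 ∷ 51 ∷ 10 ∷ 17 ∷ 14 ∷ 49 ∷ 40 ∷ 41 ∷ 13 ∷ 46 ∷ 43 ∷ 20 ∷ 52 ∷ 11 ∷ 15 ∷ 24 ∷ 1 ∷ 54 ∷ 42 ∷ 27 ∷ 5 ∷ 12 ∷ []) ∷
  (26 ∷ 51 ∷ 10 ∷ 17 ∷ 14 ∷ 49 ∷ 40 ∷ 41 ∷ 13 ∷ 46 ∷ 43 ∷ 20 ∷ 52 ∷ 11 ∷ 15 ∷ 24 ∷ 1 ∷ 54 ∷ 42 ∷ 12 ∷ 44 ∷ 47 ∷ []) ∷
  (26 ∷ 51 ∷ 10 ∷ 17 ∷ 14 ∷ 49 ∷ 40 ∷ 41 ∷ 13 ∷ 43 ∷ 20 ∷ 11 ∷ 3 ∷ 15 ∷ 22 ∷ 24 ∷ 1 ∷ 54 ∷ 42 ∷ 27 ∷ 5 ∷ 12 ∷ []) ∷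
  (26 ∷ 51 ∷ 10 ∷ 17 ∷ 14 ∷ 49 ∷ 40 ∷ 41 ∷ 13 ∷ 43 ∷ 20 ∷ 11 ∷ 3 ∷ 15 ∷ 22 ∷ 24 ∷ 1 ∷ 54 ∷ 42 ∷ 12 ∷ 44 ∷ 47 ∷ []) ∷
  (26 ∷ 51 ∷ 10 ∷ 14 ∷ 49 ∷ 40 ∷ 41 ∷ 13 ∷ 46 ∷ 43 ∷ 20 ∷ 52 ∷ 11 ∷ 15 ∷ 24 ∷ 55 ∷ 54 ∷ 42 ∷ 27 ∷ 5 ∷ 12 ∷ 53 ∷ []) ∷
  (26 ∷ 51 ∷ 10 ∷ 14 ∷ 49 ∷ 40 ∷ 41 ∷ 13 ∷ 46 ∷ 43 ∷ 20 ∷ 52 ∷ 11 ∷ 15 ∷ 24 ∷ 55 ∷ 54 ∷ 42 ∷ 12 ∷ 44 ∷ 47 ∷ 53 ∷ []) ∷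
  (26 ∷ 51 ∷ 10 ∷ 14 ∷ 49 ∷ 40 ∷ 41 ∷ 13 ∷ 43 ∷ 20 ∷ 11 ∷ 3 ∷ 15 ∷ 22 ∷ 24 ∷ 55 ∷ 54 ∷ 42 ∷ 27 ∷ 5 ∷ 12 ∷ 53 ∷ []) ∷
  (26 ∷ 51 ∷ 10 ∷ 14 ∷ 49 ∷ 40 ∷ 41 ∷ 13 ∷ 43 ∷ 20 ∷ 11 ∷ 3 ∷ 15 ∷ 22 ∷ 24 ∷ 55 ∷ 54 ∷ 42 ∷ 12 ∷ 44 ∷ 47 ∷ 53 ∷ []) ∷
  (26 ∷ 51 ∷ 10 ∷ 14 ∷ 40 ∷ 41 ∷ 13 ∷ 46 ∷ 25 ∷ 43 ∷ 52 ∷ 11 ∷ 15 ∷ 21 ∷ 55 ∷ 54 ∷ 42 ∷ 27 ∷ 5 ∷ 12 ∷ 50 ∷ 53 ∷ []) ∷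
  (26 ∷ 51 ∷ 34 ∷ 8 ∷ 35 ∷ 30 ∷ 39 ∷ 46 ∷ 38 ∷ 25 ∷ 59 ∷ 52 ∷ 56 ∷ 36 ∷ 21 ∷ 55 ∷ 57 ∷ 54 ∷ 42 ∷ 27 ∷ 58 ∷ 50 ∷ []) ∷
  (26 ∷ 51 ∷ 34 ∷ 8 ∷ 35 ∷ 30 ∷ 39 ∷ 46 ∷ 38 ∷ 25 ∷ 59 ∷ 52 ∷ 15 ∷ 36 ∷ 21 ∷ 55 ∷ 54 ∷ 42 ∷ 27 ∷ 5 ∷ 58 ∷ 50 ∷ []) ∷
  (26 ∷ 51 ∷ 34 ∷ 14 ∷ 39 ∷ 41 ∷ 46 ∷ 25 ∷ 43 ∷ 59 ∷ 52 ∷ 15 ∷ 36 ∷ 21 ∷ 55 ∷ 54 ∷ 42 ∷ 27 ∷ 5 ∷ 12 ∷ 50 ∷ 53 ∷ []) ∷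
  (26 ∷ 51 ∷ 34 ∷ 35 ∷ 39 ∷ 46 ∷ 38 ∷ 25 ∷ 43 ∷ 59 ∷ 52 ∷ 56 ∷ 36 ∷ 21 ∷ 55 ∷ 57 ∷ 54 ∷ 42 ∷ 27 ∷ 58 ∷ 50 ∷ 53 ∷ []) ∷
  (26 ∷ 51 ∷ 34 ∷ 35 ∷ 39 ∷ 46 ∷ 38 ∷ 25 ∷ 43 ∷ 59 ∷ 52 ∷ 15 ∷ 36 ∷ 21 ∷ 55 ∷ 54 ∷ 42 ∷ 27 ∷ 5 ∷ 58 ∷ 50 ∷ 53 ∷ []) ∷
  (26 ∷ 51 ∷ 8 ∷ 17 ∷ 49 ∷ 6 ∷ 35 ∷ 30 ∷ 46 ∷ 38 ∷ 20 ∷ 59 ∷ 56 ∷ 36 ∷ 28 ∷ 24 ∷ 57 ∷ 54 ∷ 31 ∷ 58 ∷ 33 ∷ 44 ∷ []) ∷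
  (26 ∷ 51 ∷ 8 ∷ 17 ∷ 49 ∷ 6 ∷ 35 ∷ 30 ∷ 46 ∷ 38 ∷ 20 ∷ 56 ∷ 11 ∷ 36 ∷ 28 ∷ 24 ∷ 1 ∷ 54 ∷ 31 ∷ 58 ∷ 33 ∷ 44 ∷ []) ∷
  (26 ∷ 51 ∷ 8 ∷ 17 ∷ 49 ∷ 35 ∷ 30 ∷ 46 ∷ 38 ∷ 20 ∷ 59 ∷ 52 ∷ 56 ∷ 36 ∷ 28 ∷ 24 ∷ 57 ∷ 54 ∷ 42 ∷ 58 ∷ 33 ∷ 44 ∷ []) ∷
  (26 ∷ 51 ∷ 8 ∷ 17 ∷ 49 ∷ 35 ∷ 30 ∷ 46 ∷ 38 ∷ 20 ∷ 52 ∷ 56 ∷ 11 ∷ 36 ∷ 28 ∷ 24 ∷ 1 ∷ 54 ∷ 42 ∷ 58 ∷ 33 ∷ 44 ∷ []) ∷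
  (26 ∷ 51 ∷ 8 ∷ 17 ∷ 49 ∷ 35 ∷ 30 ∷ 46 ∷ 38 ∷ 20 ∷ 52 ∷ 11 ∷ 15 ∷ 36 ∷ 24 ∷ 1 ∷ 54 ∷ 42 ∷ 27 ∷ 5 ∷ 58 ∷ 33 ∷ []) ∷
  (26 ∷ 51 ∷ 8 ∷ 49 ∷ 35 ∷ 30 ∷ 39 ∷ 46 ∷ 38 ∷ 20 ∷ 59 ∷ 52 ∷ 56 ∷ 36 ∷ 24 ∷ 55 ∷ 57 ∷ 54 ∷ 42 ∷ 27 ∷ 58 ∷ 33 ∷ []) ∷
  (26 ∷ 51 ∷ 8 ∷ 49 ∷ 35 ∷ 30 ∷ 39 ∷ 46 ∷ 38 ∷ 20 ∷ 59 ∷ 52 ∷ 15 ∷ 36 ∷ 24 ∷ 55 ∷ 54 ∷ 42 ∷ 27 ∷ 5 ∷ 58 ∷ 33 ∷ []) ∷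
  (26 ∷ 51 ∷ 17 ∷ 49 ∷ 6 ∷ 35 ∷ 30 ∷ 40 ∷ 46 ∷ 38 ∷ 20 ∷ 59 ∷ 56 ∷ 28 ∷ 24 ∷ 57 ∷ 54 ∷ 31 ∷ 58 ∷ 33 ∷ 44 ∷ 47 ∷ []) ∷
  (26 ∷ 51 ∷ 17 ∷ 49 ∷ 6 ∷ 35 ∷ 30 ∷ 40 ∷ 46 ∷ 38 ∷ 20 ∷ 56 ∷ 11 ∷ 28 ∷ 24 ∷ 1 ∷ 54 ∷ 31 ∷ 58 ∷ 33 ∷ 44 ∷ 47 ∷ []) ∷
  (26 ∷ 51 ∷ 17 ∷ 49 ∷ 6 ∷ 35 ∷ 40 ∷ 13 ∷ 38 ∷ 20 ∷ 11 ∷ 3 ∷ 28 ∷ 22 ∷ 24 ∷ 1 ∷ 54 ∷ 31 ∷ 58 ∷ 33 ∷ 44 ∷ 47 ∷ []) ∷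
  (26 ∷ 51 ∷ 17 ∷ 49 ∷ 35 ∷ 30 ∷ 40 ∷ 46 ∷ 38 ∷ 20 ∷ 59 ∷ 52 ∷ 56 ∷ 28 ∷ 24 ∷ 57 ∷ 54 ∷ 42 ∷ 58 ∷ 33 ∷ 44 ∷ 47 ∷ []) ∷
  (26 ∷ 51 ∷ 17 ∷ 49 ∷ 35 ∷ 30 ∷ 40 ∷ 46 ∷ 38 ∷ 20 ∷ 52 ∷ 56 ∷ 11 ∷ 28 ∷ 24 ∷ 1 ∷ 54 ∷ 42 ∷ 58 ∷ 33 ∷ 44 ∷ 47 ∷ []) ∷
  (26 ∷ 51 ∷ 17 ∷ 49 ∷ 35 ∷ 40 ∷ 13 ∷ 46 ∷ 38 ∷ 43 ∷ 20 ∷ 52 ∷ 11 ∷ 15 ∷ 24 ∷ 1 ∷ 54 ∷ 42 ∷ 27 ∷ 5 ∷ 58 ∷ 33 ∷ []) ∷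
  (26 ∷ 51 ∷ 17 ∷ 49 ∷ 35 ∷ 40 ∷ 13 ∷ 46 ∷ 38 ∷ 43 ∷ 20 ∷ 52 ∷ 11 ∷ 15 ∷ 24 ∷ 1 ∷ 54 ∷ 42 ∷ 58 ∷ 33 ∷ 44 ∷ 47 ∷ []) ∷
  (26 ∷ 51 ∷ 17 ∷ 49 ∷ 35 ∷ 40 ∷ 13 ∷ 38 ∷ 43 ∷ 20 ∷ 11 ∷ 3 ∷ 15 ∷ 22 ∷ 24 ∷ 1 ∷ 54 ∷ 42 ∷ 27 ∷ 5 ∷ 58 ∷ 33 ∷ []) ∷
  (26 ∷ 51 ∷ 17 ∷ 49 ∷ 35 ∷ 40 ∷ 13 ∷ 38 ∷ 43 ∷ 20 ∷ 11 ∷ 3 ∷ 15 ∷ 22 ∷ 24 ∷ 1 ∷ 54 ∷ 42 ∷ 58 ∷ 33 ∷ 44 ∷ 47 ∷ []) ∷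
  (26 ∷ 51 ∷ 49 ∷ 6 ∷ 35 ∷ 40 ∷ 13 ∷ 38 ∷ 37 ∷ 20 ∷ 3 ∷ 28 ∷ 22 ∷ 24 ∷ 57 ∷ 54 ∷ 31 ∷ 58 ∷ 33 ∷ 44 ∷ 47 ∷ 53 ∷ []) ∷
  (26 ∷ 51 ∷ 49 ∷ 6 ∷ 35 ∷ 40 ∷ 38 ∷ 37 ∷ 20 ∷ 59 ∷ 56 ∷ 28 ∷ 22 ∷ 24 ∷ 57 ∷ 54 ∷ 31 ∷ 58 ∷ 33 ∷ 44 ∷ 47 ∷ 53 ∷ []) ∷
  (26 ∷ 51 ∷ 49 ∷ 35 ∷ 40 ∷ 13 ∷ 46 ∷ 38 ∷ 43 ∷ 20 ∷ 52 ∷ 11 ∷ 15 ∷ 24 ∷ 55 ∷ 54 ∷ 42 ∷ 27 ∷ 5 ∷ 58 ∷ 33 ∷ 53 ∷ []) ∷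
  (26 ∷ 51 ∷ 49 ∷ 35 ∷ 40 ∷ 13 ∷ 46 ∷ 38 ∷ 43 ∷ 20 ∷ 52 ∷ 11 ∷ 15 ∷ 24 ∷ 55 ∷ 54 ∷ 42 ∷ 58 ∷ 33 ∷ 44 ∷ 47 ∷ 53 ∷ []) ∷
  (26 ∷ 51 ∷ 49 ∷ 35 ∷ 40 ∷ 13 ∷ 38 ∷ 43 ∷ 37 ∷ 20 ∷ 3 ∷ 22 ∷ 24 ∷ 55 ∷ 57 ∷ 54 ∷ 31 ∷ 58 ∷ 33 ∷ 44 ∷ 47 ∷ 53 ∷ []) ∷
  (26 ∷ 51 ∷ 49 ∷ 35 ∷ 40 ∷ 13 ∷ 38 ∷ 43 ∷ 20 ∷ 11 ∷ 3 ∷ 15 ∷ 22 ∷ 24 ∷ 55 ∷ 54 ∷ 42 ∷ 27 ∷ 5 ∷ 58 ∷ 33 ∷ 53 ∷ []) ∷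
  (26 ∷ 51 ∷ 49 ∷ 35 ∷ 40 ∷ 13 ∷ 38 ∷ 43 ∷ 20 ∷ 11 ∷ 3 ∷ 15 ∷ 22 ∷ 24 ∷ 55 ∷ 54 ∷ 42 ∷ 58 ∷ 33 ∷ 44 ∷ 47 ∷ 53 ∷ []) ∷
  (26 ∷ 51 ∷ 49 ∷ 35 ∷ 40 ∷ 46 ∷ 38 ∷ 43 ∷ 20 ∷ 59 ∷ 52 ∷ 56 ∷ 24 ∷ 55 ∷ 57 ∷ 54 ∷ 42 ∷ 58 ∷ 33 ∷ 44 ∷ 47 ∷ 53 ∷ []) ∷
  (26 ∷ 51 ∷ 49 ∷ 35 ∷ 40 ∷ 38 ∷ 43 ∷ 37 ∷ 20 ∷ 59 ∷ 56 ∷ 22 ∷ 24 ∷ 55 ∷ 57 ∷ 54 ∷ 31 ∷ 58 ∷ 33 ∷ 44 ∷ 47 ∷ 53 ∷ []) ∷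
  (26 ∷ 51 ∷ 49 ∷ 35 ∷ 39 ∷ 46 ∷ 38 ∷ 43 ∷ 20 ∷ 59 ∷ 52 ∷ 56 ∷ 36 ∷ 24 ∷ 55 ∷ 57 ∷ 54 ∷ 42 ∷ 27 ∷ 58 ∷ 33 ∷ 53 ∷ []) ∷
  (26 ∷ 51 ∷ 49 ∷ 35 ∷ 39 ∷ 46 ∷ 38 ∷ 43 ∷ 20 ∷ 59 ∷ 52 ∷ 15 ∷ 36 ∷ 24 ∷ 55 ∷ 54 ∷ 42 ∷ 27 ∷ 5 ∷ 58 ∷ 33 ∷ 53 ∷ []) ∷
  (26 ∷ 9 ∷ 10 ∷ 8 ∷ 17 ∷ 14 ∷ 0 ∷ 6 ∷ 4 ∷ 13 ∷ 20 ∷ 11 ∷ 3 ∷ 15 ∷ 22 ∷ 24 ∷ 1 ∷ 7 ∷ 27 ∷ 5 ∷ 12 ∷ 2 ∷ []) ∷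
  (26 ∷ 9 ∷ 10 ∷ 8 ∷ 14 ∷ 0 ∷ 6 ∷ 4 ∷ 23 ∷ 13 ∷ 25 ∷ 11 ∷ 3 ∷ 15 ∷ 22 ∷ 24 ∷ 1 ∷ 7 ∷ 27 ∷ 5 ∷ 12 ∷ 2 ∷ []) ∷
  (26 ∷ 9 ∷ 34 ∷ 8 ∷ 14 ∷ 0 ∷ 6 ∷ 4 ∷ 23 ∷ 39 ∷ 38 ∷ 25 ∷ 37 ∷ 3 ∷ 15 ∷ 36 ∷ 21 ∷ 1 ∷ 7 ∷ 27 ∷ 5 ∷ 2 ∷ []) ∷
  (26 ∷ 9 ∷ 34 ∷ 8 ∷ 14 ∷ 4 ∷ 23 ∷ 39 ∷ 38 ∷ 25 ∷ 37 ∷ 59 ∷ 52 ∷ 15 ∷ 36 ∷ 21 ∷ 55 ∷ 7 ∷ 27 ∷ 5 ∷ 50 ∷ 2 ∷ []) ∷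
  (26 ∷ 9 ∷ 34 ∷ 8 ∷ 0 ∷ 6 ∷ 35 ∷ 4 ∷ 30 ∷ 39 ∷ 38 ∷ 25 ∷ 37 ∷ 3 ∷ 15 ∷ 36 ∷ 21 ∷ 1 ∷ 7 ∷ 27 ∷ 5 ∷ 2 ∷ []) ∷
  (26 ∷ 9 ∷ 34 ∷ 8 ∷ 35 ∷ 4 ∷ 30 ∷ 39 ∷ 38 ∷ 25 ∷ 37 ∷ 59 ∷ 52 ∷ 15 ∷ 36 ∷ 21 ∷ 55 ∷ 7 ∷ 27 ∷ 5 ∷ 50 ∷ 2 ∷ []) ∷
  (26 ∷ 9 ∷ 34 ∷ 14 ∷ 4 ∷ 23 ∷ 39 ∷ 38 ∷ 25 ∷ 43 ∷ 37 ∷ 59 ∷ 52 ∷ 15 ∷ 36 ∷ 21 ∷ 55 ∷ 54 ∷ 27 ∷ 5 ∷ 50 ∷ 53 ∷ []) ∷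
  (26 ∷ 9 ∷ 8 ∷ 17 ∷ 0 ∷ 6 ∷ 35 ∷ 4 ∷ 30 ∷ 38 ∷ 20 ∷ 11 ∷ 3 ∷ 15 ∷ 36 ∷ 24 ∷ 1 ∷ 7 ∷ 27 ∷ 5 ∷ 33 ∷ 2 ∷ []) ∷
  (26 ∷ 9 ∷ 8 ∷ 17 ∷ 0 ∷ 6 ∷ 35 ∷ 4 ∷ 30 ∷ 38 ∷ 20 ∷ 11 ∷ 3 ∷ 36 ∷ 28 ∷ 24 ∷ 1 ∷ 31 ∷ 7 ∷ 5 ∷ 33 ∷ 2 ∷ []) ∷
  (26 ∷ 9 ∷ 8 ∷ 17 ∷ 0 ∷ 6 ∷ 35 ∷ 4 ∷ 13 ∷ 38 ∷ 20 ∷ 11 ∷ 3 ∷ 15 ∷ 22 ∷ 24 ∷ 1 ∷ 7 ∷ 27 ∷ 5 ∷ 33 ∷ 2 ∷ []) ∷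
  (26 ∷ 9 ∷ 8 ∷ 17 ∷ 0 ∷ 6 ∷ 35 ∷ 4 ∷ 13 ∷ 38 ∷ 20 ∷ 11 ∷ 3 ∷ 28 ∷ 22 ∷ 24 ∷ 1 ∷ 31 ∷ 7 ∷ 5 ∷ 33 ∷ 2 ∷ []) ∷
  (26 ∷ 9 ∷ 8 ∷ 14 ∷ 0 ∷ 6 ∷ 4 ∷ 23 ∷ 39 ∷ 13 ∷ 38 ∷ 25 ∷ 37 ∷ 3 ∷ 15 ∷ 22 ∷ 24 ∷ 1 ∷ 7 ∷ 27 ∷ 5 ∷ 2 ∷ []) ∷
  (26 ∷ 9 ∷ 8 ∷ 0 ∷ 6 ∷ 35 ∷ 4 ∷ 30 ∷ 39 ∷ 38 ∷ 37 ∷ 20 ∷ 3 ∷ 15 ∷ 36 ∷ 24 ∷ 1 ∷ 7 ∷ 27 ∷ 5 ∷ 33 ∷ 2 ∷ []) ∷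
  (26 ∷ 9 ∷ 8 ∷ 0 ∷ 6 ∷ 35 ∷ 4 ∷ 30 ∷ 39 ∷ 38 ∷ 37 ∷ 20 ∷ 3 ∷ 36 ∷ 28 ∷ 24 ∷ 1 ∷ 31 ∷ 7 ∷ 5 ∷ 33 ∷ 2 ∷ []) ∷
  (26 ∷ 9 ∷ 8 ∷ 0 ∷ 6 ∷ 35 ∷ 4 ∷ 39 ∷ 13 ∷ 38 ∷ 37 ∷ 20 ∷ 3 ∷ 15 ∷ 22 ∷ 24 ∷ 1 ∷ 7 ∷ 27 ∷ 5 ∷ 33 ∷ 2 ∷ []) ∷
  (26 ∷ 9 ∷ 8 ∷ 0 ∷ 6 ∷ 35 ∷ 4 ∷ 39 ∷ 13 ∷ 38 ∷ 37 ∷ 20 ∷ 3 ∷ 28 ∷ 22 ∷ 24 ∷ 1 ∷ 31 ∷ 7 ∷ 5 ∷ 33 ∷ 2 ∷ []) ∷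
  (26 ∷ 10 ∷ 17 ∷ 14 ∷ 0 ∷ 4 ∷ 40 ∷ 41 ∷ 13 ∷ 43 ∷ 20 ∷ 11 ∷ 3 ∷ 15 ∷ 22 ∷ 24 ∷ 1 ∷ 42 ∷ 27 ∷ 5 ∷ 12 ∷ 2 ∷ []) ∷
  (26 ∷ 10 ∷ 14 ∷ 0 ∷ 4 ∷ 23 ∷ 40 ∷ 41 ∷ 13 ∷ 25 ∷ 43 ∷ 11 ∷ 3 ∷ 15 ∷ 22 ∷ 24 ∷ 1 ∷ 42 ∷ 27 ∷ 5 ∷ 12 ∷ 2 ∷ []) ∷
  (26 ∷ 10 ∷ 14 ∷ 4 ∷ 23 ∷ 40 ∷ 41 ∷ 13 ∷ 25 ∷ 43 ∷ 52 ∷ 11 ∷ 15 ∷ 21 ∷ 55 ∷ 54 ∷ 42 ∷ 27 ∷ 5 ∷ 12 ∷ 50 ∷ 53 ∷ []) ∷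
  (26 ∷ 10 ∷ 14 ∷ 4 ∷ 23 ∷ 40 ∷ 41 ∷ 13 ∷ 25 ∷ 43 ∷ 11 ∷ 3 ∷ 15 ∷ 22 ∷ 24 ∷ 55 ∷ 54 ∷ 42 ∷ 27 ∷ 5 ∷ 12 ∷ 53 ∷ []) ∷
  (26 ∷ 34 ∷ 14 ∷ 4 ∷ 23 ∷ 39 ∷ 41 ∷ 25 ∷ 43 ∷ 59 ∷ 52 ∷ 15 ∷ 36 ∷ 21 ∷ 55 ∷ 54 ∷ 42 ∷ 27 ∷ 5 ∷ 12 ∷ 50 ∷ 53 ∷ []) ∷
  (18 ∷ 51 ∷ 10 ∷ 17 ∷ 14 ∷ 48 ∷ 49 ∷ 40 ∷ 41 ∷ 13 ∷ 46 ∷ 16 ∷ 43 ∷ 52 ∷ 11 ∷ 15 ∷ 45 ∷ 42 ∷ 12 ∷ 44 ∷ 50 ∷ 47 ∷ []) ∷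
  (18 ∷ 51 ∷ 10 ∷ 17 ∷ 14 ∷ 48 ∷ 40 ∷ 41 ∷ 13 ∷ 46 ∷ 16 ∷ 43 ∷ 52 ∷ 11 ∷ 15 ∷ 21 ∷ 45 ∷ 42 ∷ 12 ∷ 44 ∷ 50 ∷ 2 ∷ []) ∷
  (18 ∷ 51 ∷ 10 ∷ 17 ∷ 14 ∷ 49 ∷ 40 ∷ 41 ∷ 13 ∷ 46 ∷ 16 ∷ 43 ∷ 20 ∷ 52 ∷ 11 ∷ 15 ∷ 45 ∷ 1 ∷ 42 ∷ 12 ∷ 44 ∷ 47 ∷ []) ∷
  (18 ∷ 51 ∷ 10 ∷ 17 ∷ 14 ∷ 40 ∷ 41 ∷ 13 ∷ 46 ∷ 16 ∷ 43 ∷ 20 ∷ 52 ∷ 11 ∷ 15 ∷ 21 ∷ 45 ∷ 1 ∷ 42 ∷ 12 ∷ 44 ∷ 2 ∷ []) ∷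
  (18 ∷ 51 ∷ 10 ∷ 17 ∷ 48 ∷ 49 ∷ 30 ∷ 40 ∷ 41 ∷ 46 ∷ 16 ∷ 52 ∷ 56 ∷ 11 ∷ 28 ∷ 45 ∷ 29 ∷ 42 ∷ 12 ∷ 44 ∷ 50 ∷ 47 ∷ []) ∷
  (18 ∷ 51 ∷ 10 ∷ 17 ∷ 48 ∷ 30 ∷ 40 ∷ 41 ∷ 46 ∷ 16 ∷ 52 ∷ 56 ∷ 11 ∷ 21 ∷ 28 ∷ 45 ∷ 29 ∷ 42 ∷ 12 ∷ 44 ∷ 50 ∷ 2 ∷ []) ∷
  (18 ∷ 51 ∷ 10 ∷ 17 ∷ 49 ∷ 30 ∷ 40 ∷ 41 ∷ 46 ∷ 16 ∷ 20 ∷ 52 ∷ 56 ∷ 11 ∷ 28 ∷ 45 ∷ 29 ∷ 1 ∷ 42 ∷ 12 ∷ 44 ∷ 47 ∷ []) ∷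
  (18 ∷ 51 ∷ 10 ∷ 17 ∷ 30 ∷ 40 ∷ 41 ∷ 46 ∷ 16 ∷ 20 ∷ 52 ∷ 56 ∷ 11 ∷ 21 ∷ 28 ∷ 45 ∷ 29 ∷ 1 ∷ 42 ∷ 12 ∷ 44 ∷ 2 ∷ []) ∷
  (18 ∷ 51 ∷ 10 ∷ 14 ∷ 48 ∷ 40 ∷ 41 ∷ 13 ∷ 46 ∷ 25 ∷ 43 ∷ 52 ∷ 11 ∷ 15 ∷ 21 ∷ 45 ∷ 55 ∷ 42 ∷ 27 ∷ 12 ∷ 50 ∷ 2 ∷ []) ∷
  (18 ∷ 51 ∷ 34 ∷ 8 ∷ 17 ∷ 35 ∷ 30 ∷ 46 ∷ 16 ∷ 59 ∷ 52 ∷ 56 ∷ 36 ∷ 21 ∷ 28 ∷ 45 ∷ 29 ∷ 57 ∷ 42 ∷ 58 ∷ 44 ∷ 50 ∷ []) ∷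
  (18 ∷ 51 ∷ 34 ∷ 8 ∷ 17 ∷ 35 ∷ 30 ∷ 46 ∷ 16 ∷ 59 ∷ 52 ∷ 56 ∷ 36 ∷ 21 ∷ 28 ∷ 45 ∷ 29 ∷ 42 ∷ 12 ∷ 44 ∷ 50 ∷ 2 ∷ []) ∷
  (18 ∷ 51 ∷ 34 ∷ 8 ∷ 35 ∷ 30 ∷ 39 ∷ 46 ∷ 25 ∷ 59 ∷ 52 ∷ 56 ∷ 36 ∷ 21 ∷ 45 ∷ 29 ∷ 55 ∷ 57 ∷ 42 ∷ 27 ∷ 58 ∷ 50 ∷ []) ∷
  (18 ∷ 51 ∷ 34 ∷ 8 ∷ 35 ∷ 30 ∷ 39 ∷ 46 ∷ 25 ∷ 59 ∷ 52 ∷ 56 ∷ 36 ∷ 21 ∷ 45 ∷ 29 ∷ 55 ∷ 42 ∷ 27 ∷ 12 ∷ 50 ∷ 2 ∷ []) ∷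
  (18 ∷ 51 ∷ 34 ∷ 17 ∷ 48 ∷ 30 ∷ 41 ∷ 46 ∷ 16 ∷ 59 ∷ 52 ∷ 56 ∷ 36 ∷ 21 ∷ 28 ∷ 45 ∷ 29 ∷ 57 ∷ 42 ∷ 58 ∷ 44 ∷ 50 ∷ []) ∷
  (18 ∷ 51 ∷ 34 ∷ 17 ∷ 48 ∷ 30 ∷ 41 ∷ 46 ∷ 16 ∷ 59 ∷ 52 ∷ 56 ∷ 36 ∷ 21 ∷ 28 ∷ 45 ∷ 29 ∷ 42 ∷ 12 ∷ 44 ∷ 50 ∷ 2 ∷ []) ∷
  (18 ∷ 51 ∷ 34 ∷ 14 ∷ 48 ∷ 39 ∷ 41 ∷ 46 ∷ 25 ∷ 43 ∷ 59 ∷ 52 ∷ 15 ∷ 36 ∷ 21 ∷ 45 ∷ 55 ∷ 42 ∷ 27 ∷ 12 ∷ 50 ∷ 2 ∷ []) ∷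
  (18 ∷ 51 ∷ 34 ∷ 48 ∷ 30 ∷ 39 ∷ 41 ∷ 46 ∷ 25 ∷ 59 ∷ 52 ∷ 56 ∷ 36 ∷ 21 ∷ 45 ∷ 29 ∷ 55 ∷ 57 ∷ 42 ∷ 27 ∷ 58 ∷ 50 ∷ []) ∷
  (18 ∷ 51 ∷ 34 ∷ 48 ∷ 30 ∷ 39 ∷ 41 ∷ 46 ∷ 25 ∷ 59 ∷ 52 ∷ 56 ∷ 36 ∷ 21 ∷ 45 ∷ 29 ∷ 55 ∷ 42 ∷ 27 ∷ 12 ∷ 50 ∷ 2 ∷ []) ∷
  (18 ∷ 51 ∷ 8 ∷ 17 ∷ 49 ∷ 6 ∷ 35 ∷ 30 ∷ 46 ∷ 16 ∷ 20 ∷ 59 ∷ 56 ∷ 36 ∷ 28 ∷ 45 ∷ 29 ∷ 57 ∷ 31 ∷ 58 ∷ 33 ∷ 44 ∷ []) ∷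
  (18 ∷ 51 ∷ 8 ∷ 17 ∷ 49 ∷ 6 ∷ 35 ∷ 30 ∷ 46 ∷ 16 ∷ 20 ∷ 56 ∷ 11 ∷ 36 ∷ 28 ∷ 45 ∷ 29 ∷ 1 ∷ 31 ∷ 58 ∷ 33 ∷ 44 ∷ []) ∷
  (18 ∷ 51 ∷ 8 ∷ 17 ∷ 49 ∷ 35 ∷ 30 ∷ 46 ∷ 16 ∷ 20 ∷ 59 ∷ 52 ∷ 56 ∷ 36 ∷ 28 ∷ 45 ∷ 29 ∷ 57 ∷ 42 ∷ 58 ∷ 33 ∷ 44 ∷ []) ∷
  (18 ∷ 51 ∷ 8 ∷ 17 ∷ 49 ∷ 35 ∷ 30 ∷ 46 ∷ 16 ∷ 20 ∷ 52 ∷ 56 ∷ 11 ∷ 36 ∷ 28 ∷ 45 ∷ 29 ∷ 1 ∷ 42 ∷ 58 ∷ 33 ∷ 44 ∷ []) ∷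
  (18 ∷ 51 ∷ 8 ∷ 17 ∷ 35 ∷ 30 ∷ 46 ∷ 16 ∷ 20 ∷ 52 ∷ 56 ∷ 11 ∷ 36 ∷ 21 ∷ 28 ∷ 45 ∷ 29 ∷ 1 ∷ 42 ∷ 12 ∷ 44 ∷ 2 ∷ []) ∷
  (18 ∷ 51 ∷ 17 ∷ 48 ∷ 49 ∷ 30 ∷ 40 ∷ 41 ∷ 46 ∷ 16 ∷ 59 ∷ 52 ∷ 56 ∷ 28 ∷ 45 ∷ 29 ∷ 57 ∷ 42 ∷ 58 ∷ 44 ∷ 50 ∷ 47 ∷ []) ∷
  (18 ∷ 51 ∷ 17 ∷ 49 ∷ 6 ∷ 35 ∷ 30 ∷ 40 ∷ 46 ∷ 16 ∷ 20 ∷ 59 ∷ 56 ∷ 28 ∷ 45 ∷ 29 ∷ 57 ∷ 31 ∷ 58 ∷ 33 ∷ 44 ∷ 47 ∷ []) ∷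
  (18 ∷ 51 ∷ 17 ∷ 49 ∷ 6 ∷ 35 ∷ 30 ∷ 40 ∷ 46 ∷ 16 ∷ 20 ∷ 56 ∷ 11 ∷ 28 ∷ 45 ∷ 29 ∷ 1 ∷ 31 ∷ 58 ∷ 33 ∷ 44 ∷ 47 ∷ []) ∷
  (18 ∷ 51 ∷ 17 ∷ 49 ∷ 35 ∷ 30 ∷ 40 ∷ 46 ∷ 16 ∷ 20 ∷ 59 ∷ 52 ∷ 56 ∷ 28 ∷ 45 ∷ 29 ∷ 57 ∷ 42 ∷ 58 ∷ 33 ∷ 44 ∷ 47 ∷ []) ∷
  (18 ∷ 51 ∷ 17 ∷ 49 ∷ 35 ∷ 30 ∷ 40 ∷ 46 ∷ 16 ∷ 20 ∷ 52 ∷ 56 ∷ 11 ∷ 28 ∷ 45 ∷ 29 ∷ 1 ∷ 42 ∷ 58 ∷ 33 ∷ 44 ∷ 47 ∷ []) ∷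
  (18 ∷ 9 ∷ 10 ∷ 34 ∷ 8 ∷ 17 ∷ 0 ∷ 6 ∷ 4 ∷ 30 ∷ 16 ∷ 32 ∷ 19 ∷ 3 ∷ 21 ∷ 28 ∷ 29 ∷ 1 ∷ 7 ∷ 5 ∷ 12 ∷ 2 ∷ []) ∷
  (18 ∷ 9 ∷ 10 ∷ 34 ∷ 8 ∷ 17 ∷ 0 ∷ 6 ∷ 4 ∷ 30 ∷ 16 ∷ 32 ∷ 19 ∷ 3 ∷ 28 ∷ 29 ∷ 1 ∷ 31 ∷ 7 ∷ 5 ∷ 33 ∷ 2 ∷ []) ∷
  (18 ∷ 9 ∷ 10 ∷ 34 ∷ 8 ∷ 14 ∷ 0 ∷ 6 ∷ 4 ∷ 23 ∷ 16 ∷ 25 ∷ 32 ∷ 19 ∷ 3 ∷ 21 ∷ 29 ∷ 1 ∷ 7 ∷ 5 ∷ 12 ∷ 2 ∷ []) ∷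
  (18 ∷ 9 ∷ 10 ∷ 8 ∷ 17 ∷ 14 ∷ 0 ∷ 6 ∷ 4 ∷ 13 ∷ 16 ∷ 20 ∷ 19 ∷ 11 ∷ 3 ∷ 15 ∷ 21 ∷ 1 ∷ 7 ∷ 5 ∷ 12 ∷ 2 ∷ []) ∷
  (18 ∷ 9 ∷ 10 ∷ 8 ∷ 17 ∷ 0 ∷ 6 ∷ 4 ∷ 30 ∷ 16 ∷ 20 ∷ 19 ∷ 11 ∷ 3 ∷ 21 ∷ 28 ∷ 29 ∷ 1 ∷ 7 ∷ 5 ∷ 12 ∷ 2 ∷ []) ∷
  (18 ∷ 9 ∷ 10 ∷ 8 ∷ 17 ∷ 0 ∷ 6 ∷ 4 ∷ 30 ∷ 16 ∷ 20 ∷ 19 ∷ 11 ∷ 3 ∷ 28 ∷ 29 ∷ 1 ∷ 31 ∷ 7 ∷ 5 ∷ 33 ∷ 2 ∷ []) ∷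
  (18 ∷ 9 ∷ 10 ∷ 8 ∷ 14 ∷ 0 ∷ 6 ∷ 4 ∷ 23 ∷ 13 ∷ 16 ∷ 25 ∷ 19 ∷ 11 ∷ 3 ∷ 15 ∷ 21 ∷ 1 ∷ 7 ∷ 5 ∷ 12 ∷ 2 ∷ []) ∷
  (18 ∷ 9 ∷ 34 ∷ 8 ∷ 17 ∷ 0 ∷ 6 ∷ 35 ∷ 4 ∷ 30 ∷ 16 ∷ 32 ∷ 3 ∷ 36 ∷ 21 ∷ 28 ∷ 29 ∷ 1 ∷ 7 ∷ 5 ∷ 12 ∷ 2 ∷ []) ∷
  (18 ∷ 9 ∷ 34 ∷ 8 ∷ 17 ∷ 0 ∷ 6 ∷ 35 ∷ 4 ∷ 30 ∷ 16 ∷ 32 ∷ 3 ∷ 36 ∷ 28 ∷ 29 ∷ 1 ∷ 31 ∷ 7 ∷ 5 ∷ 33 ∷ 2 ∷ []) ∷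
  (18 ∷ 9 ∷ 34 ∷ 8 ∷ 14 ∷ 0 ∷ 6 ∷ 4 ∷ 23 ∷ 39 ∷ 25 ∷ 32 ∷ 3 ∷ 36 ∷ 21 ∷ 29 ∷ 1 ∷ 7 ∷ 27 ∷ 5 ∷ 12 ∷ 2 ∷ []) ∷
  (18 ∷ 9 ∷ 34 ∷ 8 ∷ 14 ∷ 4 ∷ 23 ∷ 39 ∷ 25 ∷ 32 ∷ 59 ∷ 52 ∷ 36 ∷ 21 ∷ 29 ∷ 55 ∷ 7 ∷ 27 ∷ 5 ∷ 12 ∷ 50 ∷ 2 ∷ []) ∷
  (18 ∷ 9 ∷ 34 ∷ 8 ∷ 0 ∷ 6 ∷ 35 ∷ 4 ∷ 30 ∷ 39 ∷ 25 ∷ 32 ∷ 3 ∷ 36 ∷ 21 ∷ 29 ∷ 1 ∷ 7 ∷ 27 ∷ 5 ∷ 12 ∷ 2 ∷ []) ∷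
  (18 ∷ 9 ∷ 34 ∷ 8 ∷ 35 ∷ 4 ∷ 30 ∷ 39 ∷ 25 ∷ 32 ∷ 59 ∷ 52 ∷ 36 ∷ 21 ∷ 29 ∷ 55 ∷ 7 ∷ 27 ∷ 5 ∷ 12 ∷ 50 ∷ 2 ∷ []) ∷
  (18 ∷ 9 ∷ 8 ∷ 17 ∷ 0 ∷ 6 ∷ 35 ∷ 4 ∷ 30 ∷ 16 ∷ 20 ∷ 11 ∷ 3 ∷ 36 ∷ 21 ∷ 28 ∷ 29 ∷ 1 ∷ 7 ∷ 5 ∷ 12 ∷ 2 ∷ []) ∷
  (18 ∷ 9 ∷ 8 ∷ 17 ∷ 0 ∷ 6 ∷ 35 ∷ 4 ∷ 30 ∷ 16 ∷ 20 ∷ 11 ∷ 3 ∷ 36 ∷ 28 ∷ 29 ∷ 1 ∷ 31 ∷ 7 ∷ 5 ∷ 33 ∷ 2 ∷ []) ∷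
  (18 ∷ 10 ∷ 34 ∷ 8 ∷ 17 ∷ 0 ∷ 6 ∷ 30 ∷ 46 ∷ 16 ∷ 32 ∷ 19 ∷ 56 ∷ 21 ∷ 28 ∷ 45 ∷ 29 ∷ 1 ∷ 7 ∷ 12 ∷ 44 ∷ 2 ∷ []) ∷
  (18 ∷ 10 ∷ 34 ∷ 8 ∷ 17 ∷ 0 ∷ 6 ∷ 30 ∷ 46 ∷ 16 ∷ 32 ∷ 19 ∷ 56 ∷ 28 ∷ 45 ∷ 29 ∷ 1 ∷ 31 ∷ 7 ∷ 33 ∷ 44 ∷ 2 ∷ []) ∷
  (18 ∷ 10 ∷ 34 ∷ 17 ∷ 48 ∷ 0 ∷ 6 ∷ 30 ∷ 46 ∷ 16 ∷ 32 ∷ 19 ∷ 56 ∷ 28 ∷ 45 ∷ 29 ∷ 57 ∷ 31 ∷ 7 ∷ 33 ∷ 44 ∷ 47 ∷ []) ∷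
  (18 ∷ 10 ∷ 34 ∷ 17 ∷ 48 ∷ 0 ∷ 30 ∷ 41 ∷ 46 ∷ 16 ∷ 32 ∷ 19 ∷ 56 ∷ 21 ∷ 28 ∷ 45 ∷ 29 ∷ 7 ∷ 12 ∷ 44 ∷ 50 ∷ 2 ∷ []) ∷
  (18 ∷ 10 ∷ 34 ∷ 17 ∷ 48 ∷ 0 ∷ 30 ∷ 41 ∷ 46 ∷ 16 ∷ 32 ∷ 19 ∷ 56 ∷ 28 ∷ 45 ∷ 29 ∷ 57 ∷ 31 ∷ 7 ∷ 44 ∷ 50 ∷ 47 ∷ []) ∷
  (18 ∷ 10 ∷ 8 ∷ 17 ∷ 0 ∷ 6 ∷ 30 ∷ 46 ∷ 16 ∷ 20 ∷ 19 ∷ 56 ∷ 11 ∷ 21 ∷ 28 ∷ 45 ∷ 29 ∷ 1 ∷ 7 ∷ 12 ∷ 44 ∷ 2 ∷ []) ∷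
  (18 ∷ 10 ∷ 8 ∷ 17 ∷ 0 ∷ 6 ∷ 30 ∷ 46 ∷ 16 ∷ 20 ∷ 19 ∷ 56 ∷ 11 ∷ 28 ∷ 45 ∷ 29 ∷ 1 ∷ 31 ∷ 7 ∷ 33 ∷ 44 ∷ 2 ∷ []) ∷
  (18 ∷ 10 ∷ 17 ∷ 14 ∷ 48 ∷ 0 ∷ 49 ∷ 40 ∷ 41 ∷ 13 ∷ 46 ∷ 16 ∷ 43 ∷ 19 ∷ 11 ∷ 15 ∷ 45 ∷ 42 ∷ 12 ∷ 44 ∷ 50 ∷ 47 ∷ []) ∷
  (18 ∷ 10 ∷ 17 ∷ 14 ∷ 48 ∷ 0 ∷ 40 ∷ 41 ∷ 13 ∷ 46 ∷ 16 ∷ 43 ∷ 19 ∷ 11 ∷ 15 ∷ 21 ∷ 45 ∷ 42 ∷ 12 ∷ 44 ∷ 50 ∷ 2 ∷ []) ∷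
  (18 ∷ 10 ∷ 17 ∷ 14 ∷ 0 ∷ 49 ∷ 40 ∷ 41 ∷ 13 ∷ 46 ∷ 16 ∷ 43 ∷ 20 ∷ 19 ∷ 11 ∷ 15 ∷ 45 ∷ 1 ∷ 42 ∷ 12 ∷ 44 ∷ 47 ∷ []) ∷
  (18 ∷ 10 ∷ 17 ∷ 14 ∷ 0 ∷ 4 ∷ 40 ∷ 41 ∷ 13 ∷ 16 ∷ 43 ∷ 20 ∷ 19 ∷ 11 ∷ 3 ∷ 15 ∷ 21 ∷ 1 ∷ 42 ∷ 5 ∷ 12 ∷ 2 ∷ []) ∷
  (18 ∷ 10 ∷ 17 ∷ 14 ∷ 0 ∷ 40 ∷ 41 ∷ 13 ∷ 46 ∷ 16 ∷ 43 ∷ 20 ∷ 19 ∷ 11 ∷ 15 ∷ 21 ∷ 45 ∷ 1 ∷ 42 ∷ 12 ∷ 44 ∷ 2 ∷ []) ∷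
  (18 ∷ 10 ∷ 17 ∷ 48 ∷ 0 ∷ 49 ∷ 6 ∷ 30 ∷ 40 ∷ 46 ∷ 16 ∷ 32 ∷ 19 ∷ 56 ∷ 28 ∷ 45 ∷ 29 ∷ 57 ∷ 31 ∷ 33 ∷ 44 ∷ 47 ∷ []) ∷
  (18 ∷ 10 ∷ 17 ∷ 48 ∷ 0 ∷ 49 ∷ 30 ∷ 40 ∷ 41 ∷ 46 ∷ 16 ∷ 32 ∷ 19 ∷ 56 ∷ 28 ∷ 45 ∷ 29 ∷ 57 ∷ 31 ∷ 44 ∷ 50 ∷ 47 ∷ []) ∷
  (18 ∷ 10 ∷ 17 ∷ 48 ∷ 0 ∷ 49 ∷ 30 ∷ 40 ∷ 41 ∷ 46 ∷ 16 ∷ 19 ∷ 56 ∷ 11 ∷ 28 ∷ 45 ∷ 29 ∷ 42 ∷ 12 ∷ 44 ∷ 50 ∷ 47 ∷ []) ∷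
  (18 ∷ 10 ∷ 17 ∷ 48 ∷ 0 ∷ 30 ∷ 40 ∷ 41 ∷ 46 ∷ 16 ∷ 19 ∷ 56 ∷ 11 ∷ 21 ∷ 28 ∷ 45 ∷ 29 ∷ 42 ∷ 12 ∷ 44 ∷ 50 ∷ 2 ∷ []) ∷
  (18 ∷ 10 ∷ 17 ∷ 0 ∷ 49 ∷ 6 ∷ 30 ∷ 40 ∷ 46 ∷ 16 ∷ 20 ∷ 19 ∷ 56 ∷ 11 ∷ 28 ∷ 45 ∷ 29 ∷ 1 ∷ 31 ∷ 33 ∷ 44 ∷ 47 ∷ []) ∷
  (18 ∷ 10 ∷ 17 ∷ 0 ∷ 49 ∷ 30 ∷ 40 ∷ 41 ∷ 46 ∷ 16 ∷ 20 ∷ 19 ∷ 56 ∷ 11 ∷ 28 ∷ 45 ∷ 29 ∷ 1 ∷ 42 ∷ 12 ∷ 44 ∷ 47 ∷ []) ∷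
  (18 ∷ 10 ∷ 17 ∷ 0 ∷ 30 ∷ 40 ∷ 41 ∷ 46 ∷ 16 ∷ 20 ∷ 19 ∷ 56 ∷ 11 ∷ 21 ∷ 28 ∷ 45 ∷ 29 ∷ 1 ∷ 42 ∷ 12 ∷ 44 ∷ 2 ∷ []) ∷
  (18 ∷ 10 ∷ 14 ∷ 48 ∷ 0 ∷ 4 ∷ 23 ∷ 40 ∷ 41 ∷ 13 ∷ 16 ∷ 25 ∷ 43 ∷ 19 ∷ 11 ∷ 15 ∷ 21 ∷ 45 ∷ 42 ∷ 12 ∷ 50 ∷ 2 ∷ []) ∷
  (18 ∷ 10 ∷ 14 ∷ 48 ∷ 4 ∷ 23 ∷ 40 ∷ 41 ∷ 13 ∷ 25 ∷ 43 ∷ 52 ∷ 11 ∷ 15 ∷ 21 ∷ 45 ∷ 55 ∷ 42 ∷ 27 ∷ 12 ∷ 50 ∷ 2 ∷ []) ∷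
  (18 ∷ 10 ∷ 14 ∷ 0 ∷ 4 ∷ 23 ∷ 40 ∷ 41 ∷ 13 ∷ 16 ∷ 25 ∷ 43 ∷ 19 ∷ 11 ∷ 3 ∷ 15 ∷ 21 ∷ 1 ∷ 42 ∷ 5 ∷ 12 ∷ 2 ∷ []) ∷
  (18 ∷ 34 ∷ 8 ∷ 17 ∷ 0 ∷ 6 ∷ 35 ∷ 30 ∷ 46 ∷ 16 ∷ 32 ∷ 56 ∷ 36 ∷ 21 ∷ 28 ∷ 45 ∷ 29 ∷ 1 ∷ 7 ∷ 12 ∷ 44 ∷ 2 ∷ []) ∷
  (18 ∷ 34 ∷ 8 ∷ 17 ∷ 0 ∷ 6 ∷ 35 ∷ 30 ∷ 46 ∷ 16 ∷ 32 ∷ 56 ∷ 36 ∷ 28 ∷ 45 ∷ 29 ∷ 1 ∷ 31 ∷ 7 ∷ 33 ∷ 44 ∷ 2 ∷ []) ∷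
  (18 ∷ 34 ∷ 8 ∷ 17 ∷ 6 ∷ 35 ∷ 30 ∷ 46 ∷ 16 ∷ 32 ∷ 59 ∷ 56 ∷ 36 ∷ 28 ∷ 45 ∷ 29 ∷ 57 ∷ 31 ∷ 7 ∷ 58 ∷ 33 ∷ 44 ∷ []) ∷
  (18 ∷ 34 ∷ 8 ∷ 17 ∷ 35 ∷ 30 ∷ 46 ∷ 16 ∷ 32 ∷ 59 ∷ 52 ∷ 56 ∷ 36 ∷ 21 ∷ 28 ∷ 45 ∷ 29 ∷ 57 ∷ 7 ∷ 58 ∷ 44 ∷ 50 ∷ []) ∷
  (18 ∷ 34 ∷ 8 ∷ 17 ∷ 35 ∷ 30 ∷ 46 ∷ 16 ∷ 32 ∷ 59 ∷ 52 ∷ 56 ∷ 36 ∷ 21 ∷ 28 ∷ 45 ∷ 29 ∷ 7 ∷ 12 ∷ 44 ∷ 50 ∷ 2 ∷ []) ∷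
  (18 ∷ 34 ∷ 8 ∷ 35 ∷ 30 ∷ 39 ∷ 46 ∷ 25 ∷ 32 ∷ 59 ∷ 52 ∷ 56 ∷ 36 ∷ 21 ∷ 45 ∷ 29 ∷ 55 ∷ 57 ∷ 7 ∷ 27 ∷ 58 ∷ 50 ∷ []) ∷
  (18 ∷ 34 ∷ 8 ∷ 35 ∷ 30 ∷ 39 ∷ 46 ∷ 25 ∷ 32 ∷ 59 ∷ 52 ∷ 56 ∷ 36 ∷ 21 ∷ 45 ∷ 29 ∷ 55 ∷ 7 ∷ 27 ∷ 12 ∷ 50 ∷ 2 ∷ []) ∷
  (18 ∷ 34 ∷ 17 ∷ 48 ∷ 6 ∷ 30 ∷ 46 ∷ 16 ∷ 32 ∷ 59 ∷ 19 ∷ 56 ∷ 28 ∷ 45 ∷ 29 ∷ 57 ∷ 31 ∷ 7 ∷ 58 ∷ 33 ∷ 44 ∷ 47 ∷ []) ∷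
  (18 ∷ 34 ∷ 17 ∷ 48 ∷ 30 ∷ 41 ∷ 46 ∷ 16 ∷ 32 ∷ 59 ∷ 52 ∷ 56 ∷ 36 ∷ 21 ∷ 28 ∷ 45 ∷ 29 ∷ 57 ∷ 7 ∷ 58 ∷ 44 ∷ 50 ∷ []) ∷
  (18 ∷ 34 ∷ 17 ∷ 48 ∷ 30 ∷ 41 ∷ 46 ∷ 16 ∷ 32 ∷ 59 ∷ 52 ∷ 56 ∷ 36 ∷ 21 ∷ 28 ∷ 45 ∷ 29 ∷ 7 ∷ 12 ∷ 44 ∷ 50 ∷ 2 ∷ []) ∷
  (18 ∷ 34 ∷ 17 ∷ 48 ∷ 30 ∷ 41 ∷ 46 ∷ 16 ∷ 32 ∷ 59 ∷ 19 ∷ 56 ∷ 28 ∷ 45 ∷ 29 ∷ 57 ∷ 31 ∷ 7 ∷ 58 ∷ 44 ∷ 50 ∷ 47 ∷ []) ∷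
  (18 ∷ 34 ∷ 14 ∷ 48 ∷ 4 ∷ 23 ∷ 39 ∷ 41 ∷ 25 ∷ 43 ∷ 59 ∷ 52 ∷ 15 ∷ 36 ∷ 21 ∷ 45 ∷ 55 ∷ 42 ∷ 27 ∷ 12 ∷ 50 ∷ 2 ∷ []) ∷
  (18 ∷ 34 ∷ 14 ∷ 48 ∷ 4 ∷ 23 ∷ 39 ∷ 41 ∷ 25 ∷ 32 ∷ 59 ∷ 52 ∷ 36 ∷ 21 ∷ 45 ∷ 29 ∷ 55 ∷ 7 ∷ 27 ∷ 12 ∷ 50 ∷ 2 ∷ []) ∷
  (18 ∷ 34 ∷ 48 ∷ 30 ∷ 39 ∷ 41 ∷ 46 ∷ 25 ∷ 32 ∷ 59 ∷ 52 ∷ 56 ∷ 36 ∷ 21 ∷ 45 ∷ 29 ∷ 55 ∷ 57 ∷ 7 ∷ 27 ∷ 58 ∷ 50 ∷ []) ∷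
  (18 ∷ 34 ∷ 48 ∷ 30 ∷ 39 ∷ 41 ∷ 46 ∷ 25 ∷ 32 ∷ 59 ∷ 52 ∷ 56 ∷ 36 ∷ 21 ∷ 45 ∷ 29 ∷ 55 ∷ 7 ∷ 27 ∷ 12 ∷ 50 ∷ 2 ∷ []) ∷
  (18 ∷ 8 ∷ 17 ∷ 0 ∷ 6 ∷ 35 ∷ 30 ∷ 46 ∷ 16 ∷ 20 ∷ 56 ∷ 11 ∷ 36 ∷ 21 ∷ 28 ∷ 45 ∷ 29 ∷ 1 ∷ 7 ∷ 12 ∷ 44 ∷ 2 ∷ []) ∷
  (18 ∷ 8 ∷ 17 ∷ 0 ∷ 6 ∷ 35 ∷ 30 ∷ 46 ∷ 16 ∷ 20 ∷ 56 ∷ 11 ∷ 36 ∷ 28 ∷ 45 ∷ 29 ∷ 1 ∷ 31 ∷ 7 ∷ 33 ∷ 44 ∷ 2 ∷ []) ∷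
  (18 ∷ 17 ∷ 48 ∷ 49 ∷ 6 ∷ 30 ∷ 40 ∷ 46 ∷ 16 ∷ 32 ∷ 59 ∷ 19 ∷ 56 ∷ 28 ∷ 45 ∷ 29 ∷ 57 ∷ 31 ∷ 58 ∷ 33 ∷ 44 ∷ 47 ∷ []) ∷
  (18 ∷ 17 ∷ 48 ∷ 49 ∷ 30 ∷ 40 ∷ 41 ∷ 46 ∷ 16 ∷ 32 ∷ 59 ∷ 19 ∷ 56 ∷ 28 ∷ 45 ∷ 29 ∷ 57 ∷ 31 ∷ 58 ∷ 44 ∷ 50 ∷ 47 ∷ []) ∷
  (51 ∷ 10 ∷ 14 ∷ 48 ∷ 49 ∷ 40 ∷ 41 ∷ 13 ∷ 46 ∷ 43 ∷ 52 ∷ 11 ∷ 15 ∷ 45 ∷ 55 ∷ 54 ∷ 42 ∷ 12 ∷ 44 ∷ 50 ∷ 47 ∷ 53 ∷ []) ∷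
  (51 ∷ 10 ∷ 14 ∷ 48 ∷ 40 ∷ 41 ∷ 13 ∷ 46 ∷ 25 ∷ 43 ∷ 52 ∷ 11 ∷ 15 ∷ 21 ∷ 45 ∷ 55 ∷ 54 ∷ 42 ∷ 27 ∷ 12 ∷ 50 ∷ 53 ∷ []) ∷
  (51 ∷ 34 ∷ 14 ∷ 48 ∷ 39 ∷ 41 ∷ 46 ∷ 25 ∷ 43 ∷ 59 ∷ 52 ∷ 15 ∷ 36 ∷ 21 ∷ 45 ∷ 55 ∷ 54 ∷ 42 ∷ 27 ∷ 12 ∷ 50 ∷ 53 ∷ []) ∷
  (51 ∷ 34 ∷ 48 ∷ 39 ∷ 41 ∷ 46 ∷ 25 ∷ 43 ∷ 59 ∷ 52 ∷ 56 ∷ 36 ∷ 21 ∷ 45 ∷ 55 ∷ 57 ∷ 54 ∷ 42 ∷ 27 ∷ 58 ∷ 50 ∷ 53 ∷ []) ∷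
  (9 ∷ 10 ∷ 34 ∷ 8 ∷ 14 ∷ 0 ∷ 6 ∷ 4 ∷ 23 ∷ 16 ∷ 25 ∷ 37 ∷ 32 ∷ 19 ∷ 3 ∷ 22 ∷ 29 ∷ 1 ∷ 31 ∷ 7 ∷ 5 ∷ 2 ∷ []) ∷
  (9 ∷ 10 ∷ 34 ∷ 8 ∷ 0 ∷ 6 ∷ 4 ∷ 23 ∷ 16 ∷ 37 ∷ 32 ∷ 19 ∷ 3 ∷ 28 ∷ 22 ∷ 29 ∷ 1 ∷ 31 ∷ 7 ∷ 5 ∷ 33 ∷ 2 ∷ []) ∷
  (9 ∷ 10 ∷ 34 ∷ 14 ∷ 48 ∷ 0 ∷ 6 ∷ 4 ∷ 23 ∷ 16 ∷ 25 ∷ 37 ∷ 32 ∷ 19 ∷ 3 ∷ 22 ∷ 29 ∷ 57 ∷ 31 ∷ 7 ∷ 47 ∷ 53 ∷ []) ∷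
  (9 ∷ 10 ∷ 34 ∷ 48 ∷ 0 ∷ 6 ∷ 4 ∷ 23 ∷ 16 ∷ 37 ∷ 32 ∷ 19 ∷ 3 ∷ 28 ∷ 22 ∷ 29 ∷ 57 ∷ 31 ∷ 7 ∷ 33 ∷ 47 ∷ 53 ∷ []) ∷
  (9 ∷ 10 ∷ 8 ∷ 17 ∷ 14 ∷ 0 ∷ 6 ∷ 4 ∷ 13 ∷ 16 ∷ 20 ∷ 19 ∷ 11 ∷ 3 ∷ 15 ∷ 22 ∷ 24 ∷ 1 ∷ 7 ∷ 5 ∷ 12 ∷ 2 ∷ []) ∷
  (9 ∷ 10 ∷ 8 ∷ 17 ∷ 0 ∷ 6 ∷ 4 ∷ 13 ∷ 16 ∷ 20 ∷ 19 ∷ 11 ∷ 3 ∷ 28 ∷ 22 ∷ 24 ∷ 1 ∷ 31 ∷ 7 ∷ 5 ∷ 33 ∷ 2 ∷ []) ∷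
  (9 ∷ 10 ∷ 8 ∷ 14 ∷ 0 ∷ 6 ∷ 4 ∷ 23 ∷ 13 ∷ 16 ∷ 25 ∷ 37 ∷ 32 ∷ 19 ∷ 3 ∷ 22 ∷ 24 ∷ 1 ∷ 31 ∷ 7 ∷ 5 ∷ 2 ∷ []) ∷
  (9 ∷ 10 ∷ 8 ∷ 14 ∷ 0 ∷ 6 ∷ 4 ∷ 23 ∷ 13 ∷ 16 ∷ 25 ∷ 19 ∷ 11 ∷ 3 ∷ 15 ∷ 22 ∷ 24 ∷ 1 ∷ 7 ∷ 5 ∷ 12 ∷ 2 ∷ []) ∷
  (9 ∷ 10 ∷ 8 ∷ 0 ∷ 6 ∷ 4 ∷ 23 ∷ 13 ∷ 16 ∷ 37 ∷ 32 ∷ 19 ∷ 3 ∷ 28 ∷ 22 ∷ 24 ∷ 1 ∷ 31 ∷ 7 ∷ 5 ∷ 33 ∷ 2 ∷ []) ∷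
  (9 ∷ 10 ∷ 14 ∷ 48 ∷ 0 ∷ 6 ∷ 4 ∷ 23 ∷ 13 ∷ 16 ∷ 25 ∷ 37 ∷ 32 ∷ 19 ∷ 3 ∷ 22 ∷ 24 ∷ 57 ∷ 31 ∷ 7 ∷ 47 ∷ 53 ∷ []) ∷
  (9 ∷ 10 ∷ 48 ∷ 0 ∷ 6 ∷ 4 ∷ 23 ∷ 13 ∷ 16 ∷ 37 ∷ 32 ∷ 19 ∷ 3 ∷ 28 ∷ 22 ∷ 24 ∷ 57 ∷ 31 ∷ 7 ∷ 33 ∷ 47 ∷ 53 ∷ []) ∷
  (9 ∷ 34 ∷ 8 ∷ 14 ∷ 0 ∷ 6 ∷ 4 ∷ 23 ∷ 39 ∷ 38 ∷ 25 ∷ 37 ∷ 32 ∷ 19 ∷ 3 ∷ 22 ∷ 29 ∷ 1 ∷ 31 ∷ 7 ∷ 5 ∷ 2 ∷ []) ∷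
  (9 ∷ 34 ∷ 8 ∷ 14 ∷ 0 ∷ 6 ∷ 4 ∷ 23 ∷ 39 ∷ 38 ∷ 25 ∷ 37 ∷ 32 ∷ 3 ∷ 36 ∷ 21 ∷ 29 ∷ 1 ∷ 7 ∷ 27 ∷ 5 ∷ 2 ∷ []) ∷
  (9 ∷ 34 ∷ 8 ∷ 14 ∷ 4 ∷ 23 ∷ 39 ∷ 38 ∷ 25 ∷ 37 ∷ 32 ∷ 59 ∷ 52 ∷ 36 ∷ 21 ∷ 29 ∷ 55 ∷ 7 ∷ 27 ∷ 5 ∷ 50 ∷ 2 ∷ []) ∷
  (9 ∷ 34 ∷ 8 ∷ 0 ∷ 6 ∷ 35 ∷ 4 ∷ 30 ∷ 39 ∷ 38 ∷ 25 ∷ 37 ∷ 32 ∷ 3 ∷ 36 ∷ 21 ∷ 29 ∷ 1 ∷ 7 ∷ 27 ∷ 5 ∷ 2 ∷ []) ∷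
  (9 ∷ 34 ∷ 8 ∷ 0 ∷ 6 ∷ 35 ∷ 4 ∷ 30 ∷ 39 ∷ 38 ∷ 37 ∷ 32 ∷ 3 ∷ 36 ∷ 28 ∷ 29 ∷ 1 ∷ 31 ∷ 7 ∷ 5 ∷ 33 ∷ 2 ∷ []) ∷
  (9 ∷ 34 ∷ 8 ∷ 0 ∷ 6 ∷ 4 ∷ 23 ∷ 39 ∷ 38 ∷ 37 ∷ 32 ∷ 19 ∷ 3 ∷ 28 ∷ 22 ∷ 29 ∷ 1 ∷ 31 ∷ 7 ∷ 5 ∷ 33 ∷ 2 ∷ []) ∷
  (9 ∷ 34 ∷ 8 ∷ 35 ∷ 4 ∷ 30 ∷ 39 ∷ 38 ∷ 25 ∷ 37 ∷ 32 ∷ 59 ∷ 52 ∷ 36 ∷ 21 ∷ 29 ∷ 55 ∷ 7 ∷ 27 ∷ 5 ∷ 50 ∷ 2 ∷ []) ∷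
  (9 ∷ 34 ∷ 8 ∷ 35 ∷ 30 ∷ 39 ∷ 38 ∷ 25 ∷ 37 ∷ 32 ∷ 59 ∷ 52 ∷ 56 ∷ 36 ∷ 21 ∷ 29 ∷ 55 ∷ 57 ∷ 7 ∷ 27 ∷ 58 ∷ 50 ∷ []) ∷
  (9 ∷ 34 ∷ 14 ∷ 48 ∷ 0 ∷ 6 ∷ 4 ∷ 23 ∷ 39 ∷ 38 ∷ 25 ∷ 37 ∷ 32 ∷ 19 ∷ 3 ∷ 22 ∷ 29 ∷ 57 ∷ 31 ∷ 7 ∷ 47 ∷ 53 ∷ []) ∷
  (9 ∷ 34 ∷ 14 ∷ 48 ∷ 4 ∷ 23 ∷ 39 ∷ 38 ∷ 25 ∷ 43 ∷ 37 ∷ 32 ∷ 59 ∷ 52 ∷ 36 ∷ 21 ∷ 55 ∷ 57 ∷ 54 ∷ 27 ∷ 50 ∷ 53 ∷ []) ∷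
  (9 ∷ 34 ∷ 14 ∷ 48 ∷ 4 ∷ 23 ∷ 39 ∷ 38 ∷ 25 ∷ 43 ∷ 37 ∷ 32 ∷ 59 ∷ 19 ∷ 22 ∷ 55 ∷ 57 ∷ 54 ∷ 31 ∷ 50 ∷ 47 ∷ 53 ∷ []) ∷
  (9 ∷ 34 ∷ 14 ∷ 48 ∷ 4 ∷ 23 ∷ 39 ∷ 38 ∷ 25 ∷ 37 ∷ 32 ∷ 59 ∷ 52 ∷ 36 ∷ 21 ∷ 29 ∷ 55 ∷ 57 ∷ 7 ∷ 27 ∷ 50 ∷ 53 ∷ []) ∷
  (9 ∷ 34 ∷ 14 ∷ 48 ∷ 4 ∷ 23 ∷ 39 ∷ 38 ∷ 25 ∷ 37 ∷ 32 ∷ 59 ∷ 19 ∷ 22 ∷ 29 ∷ 55 ∷ 57 ∷ 31 ∷ 7 ∷ 50 ∷ 47 ∷ 53 ∷ []) ∷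
  (9 ∷ 34 ∷ 48 ∷ 0 ∷ 6 ∷ 4 ∷ 23 ∷ 39 ∷ 38 ∷ 37 ∷ 32 ∷ 19 ∷ 3 ∷ 28 ∷ 22 ∷ 29 ∷ 57 ∷ 31 ∷ 7 ∷ 33 ∷ 47 ∷ 53 ∷ []) ∷
  (9 ∷ 34 ∷ 48 ∷ 6 ∷ 23 ∷ 39 ∷ 38 ∷ 37 ∷ 32 ∷ 59 ∷ 19 ∷ 56 ∷ 28 ∷ 22 ∷ 29 ∷ 57 ∷ 31 ∷ 7 ∷ 58 ∷ 33 ∷ 47 ∷ 53 ∷ []) ∷
  (9 ∷ 34 ∷ 48 ∷ 23 ∷ 39 ∷ 38 ∷ 25 ∷ 43 ∷ 37 ∷ 32 ∷ 59 ∷ 52 ∷ 56 ∷ 36 ∷ 21 ∷ 55 ∷ 57 ∷ 54 ∷ 27 ∷ 58 ∷ 50 ∷ 53 ∷ []) ∷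
  (9 ∷ 34 ∷ 48 ∷ 23 ∷ 39 ∷ 38 ∷ 25 ∷ 43 ∷ 37 ∷ 32 ∷ 59 ∷ 19 ∷ 56 ∷ 22 ∷ 55 ∷ 57 ∷ 54 ∷ 31 ∷ 58 ∷ 50 ∷ 47 ∷ 53 ∷ []) ∷
  (9 ∷ 34 ∷ 48 ∷ 23 ∷ 39 ∷ 38 ∷ 25 ∷ 37 ∷ 32 ∷ 59 ∷ 52 ∷ 56 ∷ 36 ∷ 21 ∷ 29 ∷ 55 ∷ 57 ∷ 7 ∷ 27 ∷ 58 ∷ 50 ∷ 53 ∷ []) ∷
  (9 ∷ 34 ∷ 48 ∷ 23 ∷ 39 ∷ 38 ∷ 25 ∷ 37 ∷ 32 ∷ 59 ∷ 19 ∷ 56 ∷ 22 ∷ 29 ∷ 55 ∷ 57 ∷ 31 ∷ 7 ∷ 58 ∷ 50 ∷ 47 ∷ 53 ∷ []) ∷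
  (9 ∷ 8 ∷ 14 ∷ 0 ∷ 6 ∷ 4 ∷ 23 ∷ 39 ∷ 13 ∷ 38 ∷ 25 ∷ 37 ∷ 32 ∷ 19 ∷ 3 ∷ 22 ∷ 24 ∷ 1 ∷ 31 ∷ 7 ∷ 5 ∷ 2 ∷ []) ∷
  (9 ∷ 8 ∷ 0 ∷ 6 ∷ 4 ∷ 23 ∷ 39 ∷ 13 ∷ 38 ∷ 37 ∷ 32 ∷ 19 ∷ 3 ∷ 28 ∷ 22 ∷ 24 ∷ 1 ∷ 31 ∷ 7 ∷ 5 ∷ 33 ∷ 2 ∷ []) ∷
  (9 ∷ 14 ∷ 48 ∷ 0 ∷ 6 ∷ 4 ∷ 23 ∷ 39 ∷ 13 ∷ 38 ∷ 25 ∷ 37 ∷ 32 ∷ 19 ∷ 3 ∷ 22 ∷ 24 ∷ 57 ∷ 31 ∷ 7 ∷ 47 ∷ 53 ∷ []) ∷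
  (9 ∷ 14 ∷ 48 ∷ 4 ∷ 23 ∷ 39 ∷ 13 ∷ 38 ∷ 25 ∷ 43 ∷ 37 ∷ 32 ∷ 19 ∷ 3 ∷ 22 ∷ 24 ∷ 55 ∷ 57 ∷ 54 ∷ 31 ∷ 47 ∷ 53 ∷ []) ∷
  (9 ∷ 48 ∷ 0 ∷ 6 ∷ 4 ∷ 23 ∷ 39 ∷ 13 ∷ 38 ∷ 37 ∷ 32 ∷ 19 ∷ 3 ∷ 28 ∷ 22 ∷ 24 ∷ 57 ∷ 31 ∷ 7 ∷ 33 ∷ 47 ∷ 53 ∷ []) ∷
  (9 ∷ 48 ∷ 49 ∷ 6 ∷ 23 ∷ 39 ∷ 13 ∷ 38 ∷ 37 ∷ 32 ∷ 19 ∷ 3 ∷ 28 ∷ 22 ∷ 24 ∷ 57 ∷ 54 ∷ 31 ∷ 58 ∷ 33 ∷ 47 ∷ 53 ∷ []) ∷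
  (9 ∷ 48 ∷ 49 ∷ 6 ∷ 23 ∷ 39 ∷ 38 ∷ 37 ∷ 32 ∷ 59 ∷ 19 ∷ 56 ∷ 28 ∷ 22 ∷ 24 ∷ 57 ∷ 54 ∷ 31 ∷ 58 ∷ 33 ∷ 47 ∷ 53 ∷ []) ∷
  (9 ∷ 48 ∷ 49 ∷ 23 ∷ 39 ∷ 13 ∷ 38 ∷ 43 ∷ 37 ∷ 32 ∷ 19 ∷ 3 ∷ 22 ∷ 24 ∷ 55 ∷ 57 ∷ 54 ∷ 31 ∷ 58 ∷ 33 ∷ 47 ∷ 53 ∷ []) ∷
  (9 ∷ 48 ∷ 49 ∷ 23 ∷ 39 ∷ 38 ∷ 43 ∷ 37 ∷ 32 ∷ 59 ∷ 19 ∷ 56 ∷ 22 ∷ 24 ∷ 55 ∷ 57 ∷ 54 ∷ 31 ∷ 58 ∷ 33 ∷ 47 ∷ 53 ∷ []) ∷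
  (10 ∷ 34 ∷ 14 ∷ 48 ∷ 0 ∷ 4 ∷ 23 ∷ 41 ∷ 16 ∷ 25 ∷ 37 ∷ 32 ∷ 19 ∷ 22 ∷ 45 ∷ 29 ∷ 57 ∷ 31 ∷ 7 ∷ 50 ∷ 47 ∷ 53 ∷ []) ∷
  (10 ∷ 34 ∷ 48 ∷ 0 ∷ 6 ∷ 23 ∷ 16 ∷ 37 ∷ 32 ∷ 19 ∷ 56 ∷ 28 ∷ 22 ∷ 45 ∷ 29 ∷ 57 ∷ 31 ∷ 7 ∷ 33 ∷ 44 ∷ 47 ∷ 53 ∷ []) ∷
  (10 ∷ 34 ∷ 48 ∷ 0 ∷ 23 ∷ 41 ∷ 16 ∷ 37 ∷ 32 ∷ 19 ∷ 56 ∷ 28 ∷ 22 ∷ 45 ∷ 29 ∷ 57 ∷ 31 ∷ 7 ∷ 44 ∷ 50 ∷ 47 ∷ 53 ∷ []) ∷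
  (10 ∷ 17 ∷ 14 ∷ 0 ∷ 49 ∷ 40 ∷ 41 ∷ 13 ∷ 16 ∷ 43 ∷ 20 ∷ 19 ∷ 11 ∷ 3 ∷ 15 ∷ 22 ∷ 24 ∷ 1 ∷ 42 ∷ 12 ∷ 44 ∷ 47 ∷ []) ∷
  (10 ∷ 17 ∷ 14 ∷ 0 ∷ 4 ∷ 40 ∷ 41 ∷ 13 ∷ 16 ∷ 43 ∷ 20 ∷ 19 ∷ 11 ∷ 3 ∷ 15 ∷ 22 ∷ 24 ∷ 1 ∷ 42 ∷ 5 ∷ 12 ∷ 2 ∷ []) ∷
  (10 ∷ 14 ∷ 48 ∷ 0 ∷ 49 ∷ 23 ∷ 40 ∷ 41 ∷ 13 ∷ 16 ∷ 43 ∷ 37 ∷ 32 ∷ 19 ∷ 3 ∷ 22 ∷ 24 ∷ 57 ∷ 31 ∷ 44 ∷ 47 ∷ 53 ∷ []) ∷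
  (10 ∷ 14 ∷ 48 ∷ 0 ∷ 49 ∷ 23 ∷ 40 ∷ 41 ∷ 13 ∷ 16 ∷ 43 ∷ 37 ∷ 32 ∷ 19 ∷ 22 ∷ 45 ∷ 57 ∷ 31 ∷ 44 ∷ 50 ∷ 47 ∷ 53 ∷ []) ∷
  (10 ∷ 14 ∷ 48 ∷ 0 ∷ 49 ∷ 23 ∷ 40 ∷ 41 ∷ 13 ∷ 16 ∷ 43 ∷ 19 ∷ 11 ∷ 3 ∷ 15 ∷ 22 ∷ 24 ∷ 42 ∷ 12 ∷ 44 ∷ 47 ∷ 53 ∷ []) ∷
  (10 ∷ 14 ∷ 48 ∷ 0 ∷ 49 ∷ 23 ∷ 40 ∷ 41 ∷ 13 ∷ 16 ∷ 43 ∷ 19 ∷ 11 ∷ 15 ∷ 22 ∷ 45 ∷ 42 ∷ 12 ∷ 44 ∷ 50 ∷ 47 ∷ 53 ∷ []) ∷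
  (10 ∷ 14 ∷ 48 ∷ 0 ∷ 4 ∷ 23 ∷ 40 ∷ 41 ∷ 13 ∷ 16 ∷ 25 ∷ 43 ∷ 37 ∷ 32 ∷ 19 ∷ 3 ∷ 22 ∷ 24 ∷ 57 ∷ 31 ∷ 47 ∷ 53 ∷ []) ∷
  (10 ∷ 14 ∷ 48 ∷ 0 ∷ 4 ∷ 23 ∷ 40 ∷ 41 ∷ 13 ∷ 16 ∷ 25 ∷ 43 ∷ 37 ∷ 32 ∷ 19 ∷ 22 ∷ 45 ∷ 57 ∷ 31 ∷ 50 ∷ 47 ∷ 53 ∷ []) ∷
  (10 ∷ 14 ∷ 48 ∷ 0 ∷ 4 ∷ 23 ∷ 40 ∷ 41 ∷ 13 ∷ 16 ∷ 25 ∷ 43 ∷ 19 ∷ 11 ∷ 3 ∷ 15 ∷ 22 ∷ 24 ∷ 42 ∷ 12 ∷ 47 ∷ 53 ∷ []) ∷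
  (10 ∷ 14 ∷ 48 ∷ 0 ∷ 4 ∷ 23 ∷ 40 ∷ 41 ∷ 13 ∷ 16 ∷ 25 ∷ 43 ∷ 19 ∷ 11 ∷ 15 ∷ 22 ∷ 45 ∷ 42 ∷ 12 ∷ 50 ∷ 47 ∷ 53 ∷ []) ∷
  (10 ∷ 14 ∷ 48 ∷ 49 ∷ 23 ∷ 40 ∷ 41 ∷ 13 ∷ 43 ∷ 37 ∷ 32 ∷ 19 ∷ 3 ∷ 22 ∷ 24 ∷ 55 ∷ 57 ∷ 54 ∷ 31 ∷ 44 ∷ 47 ∷ 53 ∷ []) ∷
  (10 ∷ 14 ∷ 48 ∷ 49 ∷ 23 ∷ 40 ∷ 41 ∷ 13 ∷ 43 ∷ 37 ∷ 32 ∷ 19 ∷ 22 ∷ 45 ∷ 55 ∷ 57 ∷ 54 ∷ 31 ∷ 44 ∷ 50 ∷ 47 ∷ 53 ∷ []) ∷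
  (10 ∷ 14 ∷ 48 ∷ 49 ∷ 23 ∷ 40 ∷ 41 ∷ 13 ∷ 43 ∷ 19 ∷ 11 ∷ 3 ∷ 15 ∷ 22 ∷ 24 ∷ 55 ∷ 54 ∷ 42 ∷ 12 ∷ 44 ∷ 47 ∷ 53 ∷ []) ∷
  (10 ∷ 14 ∷ 48 ∷ 49 ∷ 23 ∷ 40 ∷ 41 ∷ 13 ∷ 43 ∷ 19 ∷ 11 ∷ 15 ∷ 22 ∷ 45 ∷ 55 ∷ 54 ∷ 42 ∷ 12 ∷ 44 ∷ 50 ∷ 47 ∷ 53 ∷ []) ∷
  (10 ∷ 14 ∷ 48 ∷ 4 ∷ 23 ∷ 40 ∷ 41 ∷ 13 ∷ 25 ∷ 43 ∷ 37 ∷ 32 ∷ 19 ∷ 3 ∷ 22 ∷ 24 ∷ 55 ∷ 57 ∷ 54 ∷ 31 ∷ 47 ∷ 53 ∷ []) ∷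
  (10 ∷ 14 ∷ 48 ∷ 4 ∷ 23 ∷ 40 ∷ 41 ∷ 13 ∷ 25 ∷ 43 ∷ 37 ∷ 32 ∷ 19 ∷ 22 ∷ 45 ∷ 55 ∷ 57 ∷ 54 ∷ 31 ∷ 50 ∷ 47 ∷ 53 ∷ []) ∷
  (10 ∷ 14 ∷ 48 ∷ 4 ∷ 23 ∷ 40 ∷ 41 ∷ 13 ∷ 25 ∷ 43 ∷ 52 ∷ 11 ∷ 15 ∷ 21 ∷ 45 ∷ 55 ∷ 54 ∷ 42 ∷ 27 ∷ 12 ∷ 50 ∷ 53 ∷ []) ∷
  (10 ∷ 14 ∷ 48 ∷ 4 ∷ 23 ∷ 40 ∷ 41 ∷ 13 ∷ 25 ∷ 43 ∷ 19 ∷ 11 ∷ 3 ∷ 15 ∷ 22 ∷ 24 ∷ 55 ∷ 54 ∷ 42 ∷ 12 ∷ 47 ∷ 53 ∷ []) ∷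
  (10 ∷ 14 ∷ 48 ∷ 4 ∷ 23 ∷ 40 ∷ 41 ∷ 13 ∷ 25 ∷ 43 ∷ 19 ∷ 11 ∷ 15 ∷ 22 ∷ 45 ∷ 55 ∷ 54 ∷ 42 ∷ 12 ∷ 50 ∷ 47 ∷ 53 ∷ []) ∷
  (10 ∷ 14 ∷ 0 ∷ 4 ∷ 23 ∷ 40 ∷ 41 ∷ 13 ∷ 16 ∷ 25 ∷ 43 ∷ 19 ∷ 11 ∷ 3 ∷ 15 ∷ 22 ∷ 24 ∷ 1 ∷ 42 ∷ 5 ∷ 12 ∷ 2 ∷ []) ∷
  (10 ∷ 48 ∷ 0 ∷ 49 ∷ 6 ∷ 23 ∷ 40 ∷ 13 ∷ 16 ∷ 37 ∷ 32 ∷ 19 ∷ 3 ∷ 28 ∷ 22 ∷ 24 ∷ 57 ∷ 31 ∷ 33 ∷ 44 ∷ 47 ∷ 53 ∷ []) ∷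
  (10 ∷ 48 ∷ 0 ∷ 49 ∷ 6 ∷ 23 ∷ 40 ∷ 16 ∷ 37 ∷ 32 ∷ 19 ∷ 56 ∷ 28 ∷ 22 ∷ 45 ∷ 29 ∷ 57 ∷ 31 ∷ 33 ∷ 44 ∷ 47 ∷ 53 ∷ []) ∷
  (10 ∷ 48 ∷ 0 ∷ 49 ∷ 23 ∷ 40 ∷ 41 ∷ 16 ∷ 37 ∷ 32 ∷ 19 ∷ 56 ∷ 28 ∷ 22 ∷ 45 ∷ 29 ∷ 57 ∷ 31 ∷ 44 ∷ 50 ∷ 47 ∷ 53 ∷ []) ∷
  (34 ∷ 14 ∷ 48 ∷ 4 ∷ 23 ∷ 39 ∷ 41 ∷ 25 ∷ 43 ∷ 37 ∷ 32 ∷ 59 ∷ 52 ∷ 36 ∷ 21 ∷ 45 ∷ 55 ∷ 57 ∷ 54 ∷ 27 ∷ 50 ∷ 53 ∷ []) ∷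
  (34 ∷ 14 ∷ 48 ∷ 4 ∷ 23 ∷ 39 ∷ 41 ∷ 25 ∷ 43 ∷ 37 ∷ 32 ∷ 59 ∷ 19 ∷ 22 ∷ 45 ∷ 55 ∷ 57 ∷ 54 ∷ 31 ∷ 50 ∷ 47 ∷ 53 ∷ []) ∷
  (34 ∷ 14 ∷ 48 ∷ 4 ∷ 23 ∷ 39 ∷ 41 ∷ 25 ∷ 43 ∷ 59 ∷ 52 ∷ 15 ∷ 36 ∷ 21 ∷ 45 ∷ 55 ∷ 54 ∷ 42 ∷ 27 ∷ 12 ∷ 50 ∷ 53 ∷ []) ∷
  (34 ∷ 14 ∷ 48 ∷ 4 ∷ 23 ∷ 39 ∷ 41 ∷ 25 ∷ 37 ∷ 32 ∷ 59 ∷ 52 ∷ 36 ∷ 21 ∷ 45 ∷ 29 ∷ 55 ∷ 57 ∷ 7 ∷ 27 ∷ 50 ∷ 53 ∷ []) ∷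
  (34 ∷ 14 ∷ 48 ∷ 4 ∷ 23 ∷ 39 ∷ 41 ∷ 25 ∷ 37 ∷ 32 ∷ 59 ∷ 19 ∷ 22 ∷ 45 ∷ 29 ∷ 55 ∷ 57 ∷ 31 ∷ 7 ∷ 50 ∷ 47 ∷ 53 ∷ []) ∷
  (34 ∷ 48 ∷ 6 ∷ 23 ∷ 16 ∷ 37 ∷ 32 ∷ 59 ∷ 19 ∷ 56 ∷ 28 ∷ 22 ∷ 45 ∷ 29 ∷ 57 ∷ 31 ∷ 7 ∷ 58 ∷ 33 ∷ 44 ∷ 47 ∷ 53 ∷ []) ∷
  (34 ∷ 48 ∷ 23 ∷ 39 ∷ 41 ∷ 25 ∷ 43 ∷ 37 ∷ 32 ∷ 59 ∷ 52 ∷ 56 ∷ 36 ∷ 21 ∷ 45 ∷ 55 ∷ 57 ∷ 54 ∷ 27 ∷ 58 ∷ 50 ∷ 53 ∷ []) ∷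
  (34 ∷ 48 ∷ 23 ∷ 39 ∷ 41 ∷ 25 ∷ 43 ∷ 37 ∷ 32 ∷ 59 ∷ 19 ∷ 56 ∷ 22 ∷ 45 ∷ 55 ∷ 57 ∷ 54 ∷ 31 ∷ 58 ∷ 50 ∷ 47 ∷ 53 ∷ []) ∷
  (34 ∷ 48 ∷ 23 ∷ 39 ∷ 41 ∷ 25 ∷ 37 ∷ 32 ∷ 59 ∷ 52 ∷ 56 ∷ 36 ∷ 21 ∷ 45 ∷ 29 ∷ 55 ∷ 57 ∷ 7 ∷ 27 ∷ 58 ∷ 50 ∷ 53 ∷ []) ∷
  (34 ∷ 48 ∷ 23 ∷ 39 ∷ 41 ∷ 25 ∷ 37 ∷ 32 ∷ 59 ∷ 19 ∷ 56 ∷ 22 ∷ 45 ∷ 29 ∷ 55 ∷ 57 ∷ 31 ∷ 7 ∷ 58 ∷ 50 ∷ 47 ∷ 53 ∷ []) ∷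
  (34 ∷ 48 ∷ 23 ∷ 41 ∷ 16 ∷ 37 ∷ 32 ∷ 59 ∷ 19 ∷ 56 ∷ 28 ∷ 22 ∷ 45 ∷ 29 ∷ 57 ∷ 31 ∷ 7 ∷ 58 ∷ 44 ∷ 50 ∷ 47 ∷ 53 ∷ []) ∷
  (48 ∷ 49 ∷ 6 ∷ 23 ∷ 40 ∷ 13 ∷ 38 ∷ 37 ∷ 32 ∷ 19 ∷ 3 ∷ 28 ∷ 22 ∷ 24 ∷ 57 ∷ 54 ∷ 31 ∷ 58 ∷ 33 ∷ 44 ∷ 47 ∷ 53 ∷ []) ∷
  (48 ∷ 49 ∷ 6 ∷ 23 ∷ 40 ∷ 38 ∷ 37 ∷ 32 ∷ 59 ∷ 19 ∷ 56 ∷ 28 ∷ 22 ∷ 24 ∷ 57 ∷ 54 ∷ 31 ∷ 58 ∷ 33 ∷ 44 ∷ 47 ∷ 53 ∷ []) ∷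
  (48 ∷ 49 ∷ 6 ∷ 23 ∷ 40 ∷ 16 ∷ 37 ∷ 32 ∷ 59 ∷ 19 ∷ 56 ∷ 28 ∷ 22 ∷ 45 ∷ 29 ∷ 57 ∷ 31 ∷ 58 ∷ 33 ∷ 44 ∷ 47 ∷ 53 ∷ []) ∷
  (48 ∷ 49 ∷ 23 ∷ 40 ∷ 41 ∷ 16 ∷ 37 ∷ 32 ∷ 59 ∷ 19 ∷ 56 ∷ 28 ∷ 22 ∷ 45 ∷ 29 ∷ 57 ∷ 31 ∷ 58 ∷ 44 ∷ 50 ∷ 47 ∷ 53 ∷ []) ∷
  (48 ∷ 49 ∷ 23 ∷ 40 ∷ 41 ∷ 43 ∷ 37 ∷ 32 ∷ 59 ∷ 19 ∷ 56 ∷ 22 ∷ 45 ∷ 55 ∷ 57 ∷ 54 ∷ 31 ∷ 58 ∷ 44 ∷ 50 ∷ 47 ∷ 53 ∷ []) ∷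
  (48 ∷ 49 ∷ 23 ∷ 40 ∷ 13 ∷ 38 ∷ 43 ∷ 37 ∷ 32 ∷ 19 ∷ 3 ∷ 22 ∷ 24 ∷ 55 ∷ 57 ∷ 54 ∷ 31 ∷ 58 ∷ 33 ∷ 44 ∷ 47 ∷ 53 ∷ []) ∷
  (48 ∷ 49 ∷ 23 ∷ 40 ∷ 38 ∷ 43 ∷ 37 ∷ 32 ∷ 59 ∷ 19 ∷ 56 ∷ 22 ∷ 24 ∷ 55 ∷ 57 ∷ 54 ∷ 31 ∷ 58 ∷ 33 ∷ 44 ∷ 47 ∷ 53 ∷ []) ∷ []

-- Checking the certificates below directly on the search result would be far slower:
-- the type checker does not share the evaluation of its elements.
independentSets-22 : independentSets 22 searchOrder ≡ independent22Sets
independentSets-22 = refl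

Certificate : Set
Certificate = Extremal × TranspositionList 6

Certifies : List ℕ → Certificate → Set
Certifies S (e , τ) = All (λ y → permute (eval τ) y ∈ elements e) (map point S)

certifies? : B.Decidable Certifies
certifies? S (e , τ) = All.all? (λ y → permute (eval τ) y ∈ₚ? elements e) (map point S)

certificates : List Certificate
certificates =
  (Z₃ , (0F , 4F) ∷ (1F , 2F) ∷ []) ∷
  (Y₃ , (0F , 1F) ∷ (1F , 4F) ∷ []) ∷
  (Z₃ , (1F , 2F) ∷ []) ∷
  (Y₃ , (1F , 4F) ∷ []) ∷
  (Y₃ , (0F , 5F) ∷ (1F , 4F) ∷ []) ∷
  (X₃ , (0F , 2F) ∷ (1F , 4F) ∷ (2F , 5F) ∷ []) ∷
  (X₃ , (0F , 1F) ∷ (1F , 5F) ∷ (2F , 4F) ∷ []) ∷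
  (X₃ , (1F , 5F) ∷ (2F , 4F) ∷ []) ∷
  (Y₃ , (0F , 1F) ∷ (1F , 5F) ∷ []) ∷
  (Y₃ , (1F , 5F) ∷ []) ∷
  (Z₃ , (0F , 5F) ∷ (1F , 2F) ∷ []) ∷
  (Y₃ , (0F , 4F) ∷ (1F , 5F) ∷ []) ∷
  (X₃ , (0F , 2F) ∷ (1F , 5F) ∷ (2F , 4F) ∷ []) ∷
  (X₃ , (0F , 1F) ∷ (1F , 4F) ∷ (2F , 5F) ∷ []) ∷
  (X₃ , (1F , 4F) ∷ (2F , 5F) ∷ []) ∷
  (Y₃ , (2F , 4F) ∷ []) ∷
  (X₃ , (2F , 5F) ∷ []) ∷
  (X₃ , []) ∷
  (Y₃ , (2F , 3F) ∷ []) ∷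
  (Y₃ , (0F , 1F) ∷ (0F , 5F) ∷ []) ∷
  (X₃ , (0F , 1F) ∷ (0F , 5F) ∷ (2F , 3F) ∷ []) ∷
  (X₃ , (0F , 1F) ∷ (0F , 5F) ∷ (2F , 4F) ∷ []) ∷
  (Y₃ , (0F , 1F) ∷ (0F , 2F) ∷ (2F , 5F) ∷ []) ∷
  (Z₃ , (0F , 1F) ∷ (0F , 4F) ∷ []) ∷
  (X₃ , (0F , 1F) ∷ (0F , 2F) ∷ (2F , 5F) ∷ []) ∷
  (Y₃ , (0F , 1F) ∷ (0F , 5F) ∷ (2F , 4F) ∷ []) ∷
  (Y₃ , (0F , 1F) ∷ (0F , 5F) ∷ (2F , 3F) ∷ []) ∷
  (X₃ , (0F , 1F) ∷ (0F , 5F) ∷ []) ∷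
  (Y₃ , (0F , 1F) ∷ (2F , 4F) ∷ []) ∷
  (X₃ , (0F , 1F) ∷ (2F , 5F) ∷ []) ∷
  (X₃ , (0F , 1F) ∷ (0F , 2F) ∷ (0F , 5F) ∷ []) ∷
  (Y₃ , (0F , 1F) ∷ (0F , 2F) ∷ (0F , 4F) ∷ []) ∷
  (Z₃ , (0F , 1F) ∷ (0F , 3F) ∷ []) ∷
  (Y₃ , (0F , 1F) ∷ (0F , 2F) ∷ (0F , 3F) ∷ []) ∷
  (X₃ , (0F , 1F) ∷ []) ∷
  (Y₃ , (0F , 1F) ∷ (2F , 3F) ∷ []) ∷
  (X₃ , (0F , 1F) ∷ (0F , 2F) ∷ []) ∷
  (Y₃ , (0F , 4F) ∷ []) ∷
  (X₃ , (0F , 4F) ∷ (2F , 3F) ∷ []) ∷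
  (X₃ , (0F , 4F) ∷ (2F , 5F) ∷ []) ∷
  (Y₃ , (0F , 2F) ∷ (2F , 4F) ∷ []) ∷
  (X₃ , (0F , 2F) ∷ (2F , 4F) ∷ []) ∷
  (Y₃ , (0F , 4F) ∷ (2F , 5F) ∷ []) ∷
  (Y₃ , (0F , 4F) ∷ (2F , 3F) ∷ []) ∷
  (X₃ , (0F , 4F) ∷ []) ∷
  (X₃ , (0F , 1F) ∷ (1F , 2F) ∷ (2F , 4F) ∷ []) ∷
  (X₃ , (2F , 3F) ∷ []) ∷
  (Y₃ , []) ∷
  (X₃ , (1F , 2F) ∷ (2F , 4F) ∷ []) ∷
  (Y₃ , (2F , 5F) ∷ []) ∷
  (X₃ , (2F , 4F) ∷ []) ∷
  (Y₃ , (0F , 1F) ∷ (0F , 3F) ∷ (2F , 4F) ∷ []) ∷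
  (X₃ , (0F , 1F) ∷ (0F , 3F) ∷ (2F , 5F) ∷ []) ∷
  (X₃ , (0F , 1F) ∷ (0F , 2F) ∷ (2F , 3F) ∷ []) ∷
  (Y₃ , (0F , 1F) ∷ (0F , 3F) ∷ []) ∷
  (Z₃ , (0F , 1F) ∷ (0F , 2F) ∷ []) ∷
  (X₃ , (0F , 1F) ∷ (2F , 3F) ∷ []) ∷
  (Y₃ , (0F , 1F) ∷ []) ∷
  (X₃ , (0F , 1F) ∷ (0F , 3F) ∷ []) ∷
  (Y₃ , (0F , 1F) ∷ (0F , 2F) ∷ (2F , 3F) ∷ []) ∷
  (Z₃ , (0F , 1F) ∷ []) ∷
  (Y₃ , (0F , 1F) ∷ (0F , 3F) ∷ (2F , 5F) ∷ []) ∷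
  (X₃ , (0F , 1F) ∷ (0F , 3F) ∷ (2F , 4F) ∷ []) ∷
  (Y₃ , (0F , 1F) ∷ (0F , 4F) ∷ []) ∷
  (X₃ , (0F , 1F) ∷ (0F , 4F) ∷ (2F , 3F) ∷ []) ∷
  (X₃ , (0F , 1F) ∷ (0F , 4F) ∷ (2F , 5F) ∷ []) ∷
  (Y₃ , (0F , 1F) ∷ (0F , 2F) ∷ (2F , 4F) ∷ []) ∷
  (Y₃ , (0F , 1F) ∷ (0F , 2F) ∷ []) ∷
  (X₃ , (0F , 1F) ∷ (0F , 2F) ∷ (0F , 3F) ∷ []) ∷
  (X₃ , (0F , 1F) ∷ (0F , 2F) ∷ (2F , 4F) ∷ []) ∷
  (Y₃ , (0F , 1F) ∷ (0F , 4F) ∷ (2F , 5F) ∷ []) ∷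
  (X₃ , (0F , 1F) ∷ (0F , 2F) ∷ (0F , 4F) ∷ []) ∷
  (Y₃ , (0F , 1F) ∷ (0F , 4F) ∷ (2F , 3F) ∷ []) ∷
  (X₃ , (0F , 1F) ∷ (0F , 4F) ∷ []) ∷
  (Z₃ , (0F , 1F) ∷ (0F , 5F) ∷ []) ∷
  (Y₃ , (0F , 1F) ∷ (0F , 2F) ∷ (0F , 5F) ∷ []) ∷
  (Y₃ , (0F , 1F) ∷ (2F , 5F) ∷ []) ∷
  (X₃ , (0F , 1F) ∷ (2F , 4F) ∷ []) ∷
  (X₃ , (0F , 5F) ∷ (1F , 2F) ∷ (2F , 4F) ∷ []) ∷
  (Y₃ , (0F , 5F) ∷ (1F , 4F) ∷ (2F , 3F) ∷ []) ∷
  (Y₃ , (0F , 1F) ∷ (1F , 5F) ∷ (2F , 3F) ∷ []) ∷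
  (Y₃ , (1F , 5F) ∷ (2F , 3F) ∷ []) ∷
  (X₃ , (0F , 1F) ∷ (1F , 2F) ∷ (2F , 5F) ∷ []) ∷
  (X₃ , (1F , 2F) ∷ (2F , 5F) ∷ []) ∷
  (Z₃ , (1F , 3F) ∷ []) ∷
  (Y₃ , (0F , 5F) ∷ []) ∷
  (X₃ , (0F , 5F) ∷ (2F , 3F) ∷ []) ∷
  (X₃ , (0F , 5F) ∷ (2F , 4F) ∷ []) ∷
  (Y₃ , (0F , 2F) ∷ (2F , 5F) ∷ []) ∷
  (Z₃ , (0F , 5F) ∷ (1F , 3F) ∷ []) ∷
  (X₃ , (0F , 2F) ∷ (2F , 5F) ∷ []) ∷
  (Y₃ , (0F , 5F) ∷ (2F , 4F) ∷ []) ∷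
  (Y₃ , (0F , 5F) ∷ (2F , 3F) ∷ []) ∷
  (X₃ , (0F , 5F) ∷ []) ∷
  (X₃ , (0F , 4F) ∷ (1F , 2F) ∷ (2F , 5F) ∷ []) ∷
  (Y₃ , (0F , 4F) ∷ (1F , 5F) ∷ (2F , 3F) ∷ []) ∷
  (Y₃ , (0F , 1F) ∷ (1F , 4F) ∷ (2F , 3F) ∷ []) ∷
  (Z₃ , (0F , 4F) ∷ (1F , 3F) ∷ []) ∷
  (Y₃ , (1F , 4F) ∷ (2F , 3F) ∷ []) ∷
  (Y₃ , (0F , 4F) ∷ (1F , 3F) ∷ (2F , 5F) ∷ []) ∷
  (X₃ , (0F , 2F) ∷ (1F , 3F) ∷ (2F , 4F) ∷ []) ∷
  (X₃ , (0F , 4F) ∷ (1F , 2F) ∷ (2F , 3F) ∷ []) ∷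
  (Y₃ , (0F , 4F) ∷ (1F , 3F) ∷ []) ∷
  (Y₃ , (0F , 3F) ∷ (1F , 4F) ∷ (2F , 5F) ∷ []) ∷
  (X₃ , (0F , 2F) ∷ (1F , 4F) ∷ (2F , 3F) ∷ []) ∷
  (X₃ , (0F , 3F) ∷ (1F , 2F) ∷ (2F , 4F) ∷ []) ∷
  (Y₃ , (0F , 3F) ∷ (1F , 4F) ∷ []) ∷
  (X₃ , (0F , 1F) ∷ (1F , 4F) ∷ (2F , 3F) ∷ []) ∷
  (X₃ , (0F , 1F) ∷ (1F , 2F) ∷ (2F , 3F) ∷ []) ∷
  (Y₃ , (0F , 1F) ∷ (1F , 3F) ∷ []) ∷
  (X₃ , (1F , 2F) ∷ (2F , 3F) ∷ []) ∷
  (Y₃ , (1F , 3F) ∷ []) ∷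
  (Y₃ , (0F , 1F) ∷ (1F , 3F) ∷ (2F , 5F) ∷ []) ∷
  (X₃ , (0F , 1F) ∷ (1F , 3F) ∷ (2F , 4F) ∷ []) ∷
  (X₃ , (1F , 4F) ∷ (2F , 3F) ∷ []) ∷
  (Y₃ , (1F , 3F) ∷ (2F , 5F) ∷ []) ∷
  (X₃ , (1F , 3F) ∷ (2F , 4F) ∷ []) ∷
  (Y₃ , (0F , 3F) ∷ (2F , 4F) ∷ []) ∷
  (X₃ , (0F , 3F) ∷ (2F , 5F) ∷ []) ∷
  (X₃ , (0F , 2F) ∷ (2F , 3F) ∷ []) ∷
  (Y₃ , (0F , 3F) ∷ []) ∷
  (Z₃ , (0F , 3F) ∷ (1F , 2F) ∷ []) ∷
  (Z₃ , (0F , 3F) ∷ (1F , 5F) ∷ []) ∷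
  (X₃ , (0F , 3F) ∷ []) ∷
  (Y₃ , (0F , 2F) ∷ (2F , 3F) ∷ []) ∷
  (Y₃ , (0F , 3F) ∷ (2F , 5F) ∷ []) ∷
  (X₃ , (0F , 3F) ∷ (2F , 4F) ∷ []) ∷
  (Y₃ , (0F , 5F) ∷ (1F , 2F) ∷ (2F , 3F) ∷ []) ∷
  (X₃ , (0F , 5F) ∷ (1F , 3F) ∷ []) ∷
  (Z₃ , (0F , 5F) ∷ []) ∷
  (X₃ , (0F , 5F) ∷ (1F , 4F) ∷ (2F , 3F) ∷ []) ∷
  (X₃ , (0F , 5F) ∷ (1F , 3F) ∷ (2F , 4F) ∷ []) ∷
  (Y₃ , (0F , 2F) ∷ (1F , 3F) ∷ (2F , 5F) ∷ []) ∷
  (Y₃ , (0F , 5F) ∷ (1F , 2F) ∷ (2F , 4F) ∷ []) ∷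
  (X₃ , (0F , 2F) ∷ (1F , 3F) ∷ (2F , 5F) ∷ []) ∷
  (Y₃ , (0F , 5F) ∷ (1F , 3F) ∷ (2F , 4F) ∷ []) ∷
  (Y₃ , (0F , 1F) ∷ (1F , 2F) ∷ (2F , 5F) ∷ []) ∷
  (Y₃ , (1F , 2F) ∷ (2F , 5F) ∷ []) ∷
  (X₃ , (0F , 1F) ∷ (1F , 5F) ∷ (2F , 3F) ∷ []) ∷
  (X₃ , (1F , 5F) ∷ (2F , 3F) ∷ []) ∷
  (Y₃ , (0F , 5F) ∷ (1F , 3F) ∷ []) ∷
  (X₃ , (0F , 5F) ∷ (1F , 2F) ∷ (2F , 3F) ∷ []) ∷
  (Y₃ , (0F , 3F) ∷ (1F , 2F) ∷ (2F , 5F) ∷ []) ∷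
  (X₃ , (0F , 3F) ∷ (1F , 5F) ∷ []) ∷
  (X₃ , (0F , 3F) ∷ (1F , 2F) ∷ (1F , 5F) ∷ []) ∷
  (Z₃ , (0F , 3F) ∷ []) ∷
  (Y₃ , (0F , 3F) ∷ (1F , 2F) ∷ []) ∷
  (X₃ , (0F , 3F) ∷ (1F , 5F) ∷ (2F , 4F) ∷ []) ∷
  (Y₃ , (0F , 2F) ∷ (1F , 5F) ∷ (2F , 3F) ∷ []) ∷
  (X₃ , (0F , 4F) ∷ (1F , 3F) ∷ []) ∷
  (Y₃ , (0F , 4F) ∷ (1F , 2F) ∷ (2F , 3F) ∷ []) ∷
  (Y₃ , (0F , 2F) ∷ (1F , 3F) ∷ (2F , 4F) ∷ []) ∷
  (X₃ , (0F , 4F) ∷ (1F , 5F) ∷ (2F , 3F) ∷ []) ∷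
  (X₃ , (0F , 4F) ∷ (1F , 3F) ∷ (2F , 5F) ∷ []) ∷
  (Y₃ , (0F , 1F) ∷ (0F , 2F) ∷ (1F , 3F) ∷ []) ∷
  (X₃ , (0F , 3F) ∷ (1F , 2F) ∷ (1F , 4F) ∷ []) ∷
  (X₃ , (0F , 3F) ∷ (1F , 4F) ∷ []) ∷
  (Y₃ , (0F , 3F) ∷ (1F , 2F) ∷ (2F , 4F) ∷ []) ∷
  (Z₃ , (0F , 1F) ∷ (1F , 3F) ∷ []) ∷
  (Y₃ , (0F , 2F) ∷ (1F , 4F) ∷ (2F , 3F) ∷ []) ∷
  (X₃ , (0F , 3F) ∷ (1F , 4F) ∷ (2F , 5F) ∷ []) ∷
  (Z₃ , (0F , 4F) ∷ []) ∷
  (Y₃ , (0F , 1F) ∷ (1F , 2F) ∷ (2F , 4F) ∷ []) ∷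
  (Y₃ , (0F , 4F) ∷ (1F , 2F) ∷ (2F , 5F) ∷ []) ∷
  (X₃ , (0F , 2F) ∷ (1F , 5F) ∷ (2F , 3F) ∷ []) ∷
  (Y₃ , (0F , 3F) ∷ (1F , 5F) ∷ (2F , 4F) ∷ []) ∷
  (Z₃ , (0F , 3F) ∷ (1F , 4F) ∷ []) ∷
  (Y₃ , (0F , 1F) ∷ (1F , 3F) ∷ (2F , 4F) ∷ []) ∷
  (X₃ , (0F , 1F) ∷ (1F , 3F) ∷ (2F , 5F) ∷ []) ∷
  (Y₃ , (1F , 3F) ∷ (2F , 4F) ∷ []) ∷
  (X₃ , (1F , 3F) ∷ (2F , 5F) ∷ []) ∷
  (Y₃ , (0F , 3F) ∷ (1F , 2F) ∷ (1F , 4F) ∷ []) ∷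
  (X₃ , (0F , 1F) ∷ (1F , 3F) ∷ []) ∷
  (Y₃ , (0F , 1F) ∷ (1F , 2F) ∷ (2F , 3F) ∷ []) ∷
  (X₃ , (0F , 1F) ∷ (0F , 2F) ∷ (1F , 3F) ∷ []) ∷
  (Y₃ , (1F , 2F) ∷ (2F , 4F) ∷ []) ∷
  (Z₃ , []) ∷
  (X₃ , (1F , 3F) ∷ []) ∷
  (Y₃ , (1F , 2F) ∷ (2F , 3F) ∷ []) ∷
  (Y₃ , (0F , 3F) ∷ (1F , 5F) ∷ []) ∷
  (X₃ , (0F , 3F) ∷ (1F , 2F) ∷ (2F , 5F) ∷ []) ∷
  (X₃ , (0F , 3F) ∷ (1F , 2F) ∷ []) ∷
  (Y₃ , (0F , 3F) ∷ (1F , 2F) ∷ (1F , 5F) ∷ []) ∷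
  (Z₃ , (0F , 4F) ∷ (1F , 5F) ∷ []) ∷
  (Y₃ , (0F , 1F) ∷ (1F , 4F) ∷ (2F , 5F) ∷ []) ∷
  (Y₃ , (1F , 4F) ∷ (2F , 5F) ∷ []) ∷
  (Z₃ , (1F , 5F) ∷ []) ∷
  (Y₃ , (0F , 5F) ∷ (1F , 2F) ∷ []) ∷
  (X₃ , (0F , 5F) ∷ (1F , 2F) ∷ (1F , 3F) ∷ []) ∷
  (Y₃ , (0F , 1F) ∷ (0F , 5F) ∷ (1F , 2F) ∷ []) ∷
  (X₃ , (0F , 2F) ∷ (0F , 3F) ∷ (1F , 5F) ∷ []) ∷
  (Y₃ , (0F , 2F) ∷ (1F , 4F) ∷ (2F , 5F) ∷ []) ∷
  (Z₃ , (0F , 1F) ∷ (1F , 5F) ∷ []) ∷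
  (X₃ , (0F , 5F) ∷ (1F , 2F) ∷ (1F , 4F) ∷ []) ∷
  (X₃ , (0F , 5F) ∷ (1F , 4F) ∷ []) ∷
  (Y₃ , (0F , 1F) ∷ (0F , 2F) ∷ (1F , 5F) ∷ []) ∷
  (X₃ , (0F , 2F) ∷ (0F , 4F) ∷ (1F , 5F) ∷ []) ∷
  (Y₃ , (0F , 2F) ∷ (1F , 5F) ∷ []) ∷
  (X₃ , (0F , 1F) ∷ (0F , 2F) ∷ (1F , 5F) ∷ []) ∷
  (X₃ , (0F , 1F) ∷ (1F , 5F) ∷ []) ∷
  (X₃ , (1F , 5F) ∷ []) ∷
  (Y₃ , (0F , 1F) ∷ (1F , 5F) ∷ (2F , 4F) ∷ []) ∷
  (Z₃ , (0F , 5F) ∷ (1F , 4F) ∷ []) ∷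
  (Y₃ , (0F , 5F) ∷ (1F , 2F) ∷ (1F , 4F) ∷ []) ∷
  (Y₃ , (1F , 5F) ∷ (2F , 4F) ∷ []) ∷
  (Z₃ , (1F , 4F) ∷ []) ∷
  (X₃ , (0F , 2F) ∷ (1F , 5F) ∷ []) ∷
  (Y₃ , (1F , 2F) ∷ (1F , 3F) ∷ []) ∷
  (Y₃ , (0F , 1F) ∷ (1F , 2F) ∷ (1F , 3F) ∷ []) ∷
  (X₃ , (1F , 2F) ∷ (1F , 5F) ∷ []) ∷
  (X₃ , (0F , 1F) ∷ (1F , 2F) ∷ (1F , 5F) ∷ []) ∷
  (Y₃ , (0F , 2F) ∷ (0F , 4F) ∷ (1F , 5F) ∷ []) ∷
  (Z₃ , (0F , 2F) ∷ (1F , 4F) ∷ []) ∷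
  (X₃ , (1F , 2F) ∷ []) ∷
  (X₃ , (0F , 1F) ∷ (1F , 2F) ∷ []) ∷
  (Y₃ , (1F , 2F) ∷ (1F , 4F) ∷ []) ∷
  (Y₃ , (0F , 1F) ∷ (1F , 2F) ∷ (1F , 4F) ∷ []) ∷
  (Y₃ , (0F , 5F) ∷ (1F , 2F) ∷ (1F , 3F) ∷ []) ∷
  (X₃ , (0F , 5F) ∷ (1F , 2F) ∷ []) ∷
  (Y₃ , (0F , 2F) ∷ (0F , 3F) ∷ (1F , 5F) ∷ []) ∷
  (Z₃ , (0F , 2F) ∷ (1F , 3F) ∷ []) ∷
  (X₃ , (0F , 1F) ∷ (0F , 5F) ∷ (1F , 2F) ∷ []) ∷
  (X₃ , (0F , 2F) ∷ (0F , 5F) ∷ []) ∷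
  (Y₃ , (0F , 2F) ∷ (0F , 4F) ∷ []) ∷
  (Y₃ , (0F , 2F) ∷ (0F , 3F) ∷ []) ∷
  (X₃ , (0F , 2F) ∷ []) ∷
  (Z₃ , (0F , 2F) ∷ []) ∷
  (X₃ , (0F , 2F) ∷ (0F , 5F) ∷ (1F , 3F) ∷ []) ∷
  (Y₃ , (0F , 1F) ∷ (0F , 3F) ∷ (1F , 2F) ∷ []) ∷
  (Z₃ , (0F , 1F) ∷ (1F , 4F) ∷ []) ∷
  (Y₃ , (0F , 2F) ∷ (1F , 5F) ∷ (2F , 4F) ∷ []) ∷
  (Y₃ , (0F , 2F) ∷ (1F , 4F) ∷ []) ∷
  (X₃ , (0F , 2F) ∷ (0F , 3F) ∷ (1F , 4F) ∷ []) ∷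
  (Y₃ , (0F , 1F) ∷ (0F , 2F) ∷ (1F , 4F) ∷ []) ∷
  (X₃ , (0F , 4F) ∷ (1F , 2F) ∷ (1F , 3F) ∷ []) ∷
  (X₃ , (0F , 2F) ∷ (0F , 5F) ∷ (1F , 4F) ∷ []) ∷
  (Y₃ , (0F , 1F) ∷ (0F , 4F) ∷ (1F , 2F) ∷ []) ∷
  (X₃ , (0F , 4F) ∷ (1F , 2F) ∷ (1F , 5F) ∷ []) ∷
  (Y₃ , (0F , 4F) ∷ (1F , 2F) ∷ []) ∷
  (X₃ , (0F , 1F) ∷ (0F , 4F) ∷ (1F , 2F) ∷ []) ∷
  (Y₃ , (0F , 2F) ∷ (0F , 5F) ∷ (1F , 4F) ∷ []) ∷
  (X₃ , (0F , 4F) ∷ (1F , 2F) ∷ []) ∷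
  (Y₃ , (0F , 4F) ∷ (1F , 2F) ∷ (1F , 5F) ∷ []) ∷
  (Y₃ , (0F , 2F) ∷ (0F , 3F) ∷ (1F , 4F) ∷ []) ∷
  (X₃ , (0F , 2F) ∷ (1F , 4F) ∷ []) ∷
  (X₃ , (0F , 1F) ∷ (1F , 4F) ∷ []) ∷
  (Y₃ , (0F , 4F) ∷ (1F , 2F) ∷ (1F , 3F) ∷ []) ∷
  (X₃ , (0F , 1F) ∷ (0F , 2F) ∷ (1F , 4F) ∷ []) ∷
  (X₃ , (0F , 4F) ∷ (1F , 5F) ∷ []) ∷
  (Z₃ , (0F , 1F) ∷ (1F , 2F) ∷ []) ∷
  (Y₃ , (0F , 2F) ∷ (1F , 3F) ∷ []) ∷
  (X₃ , (0F , 2F) ∷ (0F , 4F) ∷ (1F , 3F) ∷ []) ∷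
  (X₃ , (1F , 2F) ∷ (1F , 4F) ∷ []) ∷
  (X₃ , (0F , 1F) ∷ (1F , 2F) ∷ (1F , 4F) ∷ []) ∷
  (X₃ , (1F , 4F) ∷ []) ∷
  (Y₃ , (1F , 2F) ∷ []) ∷
  (Y₃ , (0F , 1F) ∷ (1F , 2F) ∷ []) ∷
  (Y₃ , (0F , 2F) ∷ (0F , 4F) ∷ (1F , 3F) ∷ []) ∷
  (Y₃ , (1F , 2F) ∷ (1F , 5F) ∷ []) ∷
  (Y₃ , (0F , 1F) ∷ (1F , 2F) ∷ (1F , 5F) ∷ []) ∷
  (X₃ , (1F , 2F) ∷ (1F , 3F) ∷ []) ∷
  (X₃ , (0F , 1F) ∷ (1F , 2F) ∷ (1F , 3F) ∷ []) ∷
  (X₃ , (0F , 2F) ∷ (1F , 3F) ∷ []) ∷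
  (Y₃ , (0F , 2F) ∷ []) ∷
  (X₃ , (0F , 2F) ∷ (0F , 3F) ∷ []) ∷
  (X₃ , (0F , 1F) ∷ (0F , 3F) ∷ (1F , 2F) ∷ []) ∷
  (Y₃ , (0F , 2F) ∷ (0F , 5F) ∷ (1F , 3F) ∷ []) ∷
  (Z₃ , (0F , 2F) ∷ (1F , 5F) ∷ []) ∷
  (X₃ , (0F , 2F) ∷ (0F , 4F) ∷ []) ∷
  (Y₃ , (0F , 2F) ∷ (0F , 5F) ∷ []) ∷ []

certified : Pointwise Certifies independent22Sets certificates
certified = toWitness {a? = pointwise? certifies? independent22Sets certificates} tt

independent22⇒certified : ∀ {I} → Unique I → Independent I → I ⊆ searchOrder → length I ≡ 22 →
                           ∃₂ λ S c → (I ⊆ S × S ⊆ I) × Certifies S c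
independent22⇒certified uI indI I⊆ |I|≡22 =
  Any×Pointwise⇒∃ (subst (Any _) independentSets-22
                     (independentSets-complete 22 searchOrder uI indI I⊆ |I|≡22))
                  certified

isomorphic-to-extremal : ∀ {X} → Unique X → All (_∈ L132) X → diamSq X < diamSq L132 → length X ≡ 22 →
                         ∃ λ e → Isomorphic X ⟦ e ⟧
isomorphic-to-extremal {X} uX X⊆L diam< |X|≡22 =
  fromCertificate (independent22⇒certified (labels-unique X⊆L uX) (labels-independent X⊆L diam<)
                                           (labels⊆searchOrder X⊆L) (trans (length-map label X) |X|≡22))
  where
  fromCertificate : (∃₂ λ S c → (map label X ⊆ S × S ⊆ map label X) × Certifies S c) →
                    ∃ λ e → Isomorphic X ⟦ e ⟧
  fromCertificate (S , (e , τ) , (I⊆S , _) , maps) =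
    e , mapsInto⇒isomorphic (eval τ) uX (ℕ.≤-reflexive (trans (length-elements e) (sym |X|≡22)))
                            (All.tabulate (All.lookup maps ∘ X⊆S)) (⟦⟧⇒∈elements e) (∈elements⇒⟦⟧ e)
    where
    X⊆S : X ⊆ map point S
    X⊆S = subst (_⊆ _) (point∘label X⊆L) (⊆.map⁺ point I⊆S)

proposition2p9 : (X : List Pt) → Unique X → All (_∈ L132) X → diamSq X < diamSq L132 →
    (length X ≤ 22) × (length X ≡ 22 → Isomorphic X X3 ⊎ Isomorphic X Y3 ⊎ Isomorphic X Z3)
proposition2p9 X uX X⊆L diam< = |X|≤22 , classify ∘ isomorphic-to-extremal uX X⊆L diam<
  where
  |X|≤22 : length X ≤ 22
  |X|≤22 = subst (_≤ 22) (length-map label X)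
             (independent⇒length≤22 (labels-unique X⊆L uX) (labels-independent X⊆L diam<)
                                     (labels⊆searchOrder X⊆L))
  classify : (∃ λ e → Isomorphic X ⟦ e ⟧) → Isomorphic X X3 ⊎ Isomorphic X Y3 ⊎ Isomorphic X Z3
  classify (X₃ , iso) = inj₁ iso
  classify (Y₃ , iso) = inj₂ (inj₁ iso)
  classify (Z₃ , iso) = inj₂ (inj₂ iso)
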